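{- Let $n\ge 2$ and $k\ge 1$ be integers. The number of well-formed Hamiltonian paths in the Inscribed Graph $I_n^k$ from its leftmost vertex to its rightmost vertex equals the number $S_{n,k}$ of tiling-paths on the Overall Graph $O_n(k)$, and the number of well-formed Hamiltonian cycles in $I_n^k$ equals the number $D_{n,k}$ of tiling-cycles on $O_n(k)$.
   Context: For an integer $n\ge 2$, the generator pattern $F_n$ is an equilateral triangle of side length $n$ (horizontal base, apex up) subdivided by lines parallel to its sides into $n^2$ unit equilateral triangles ("tiles"); the $T_n=n(n+1)/2$ tiles pointing upwards are dark, the downward ones white. Set $F_n(1)=F_n$, and for $k\ge 2$ obtain $F_n(k)$ from $F_n$ by replacing every dark tile with a correspondingly scaled copy of $F_n(k-1)$; $F_n(k)$ has $T_n^k$ dark tiles. Inscribed Graph $I_n^k$: vertices are the centroids of the dark tiles of $F_n(k)$, two vertices adjacent iff the two distinct dark tiles share at least one point. Every edge of $I_n^k$, traversed in a given direction, has one of six directions, encoded by $d\in\{0,1,\dots,5\}$ meaning the angle $60^\circ\cdot d$ measured counterclockwise from the rightward horizontal. A directed path (or cycle, including the turn from its last edge back to its first) with consecutive edge directions $d_i,d_{i+1}$ is well-formed if at every turn $d_{i+1}\not\equiv d_i+3 \pmod 6$ and, moreover, $d_{i+1}\not\equiv d_i+4\pmod 6$ when $d_i$ is even and $d_{i+1}\not\equiv d_i+2 \pmod 6$ when $d_i$ is odd. The leftmost (resp. rightmost) vertex of $I_n^k$ is the centroid of the dark tile at the bottom-left (resp. bottom-right) corner of the big triangle; paths are oriented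 from the leftmost to the rightmost vertex, and a cycle is well-formed if it is so for some orientation. Overall Graph $O_n(k)$: vertices are all corners of dark tiles of $F_n(k)$, edges are the sides of dark tiles. A tiling-path on $O_n(k)$ is a self-avoiding path in $O_n(k)$ from the bottom-left corner to the bottom-right corner of the big triangle consisting of $T_n^k$ edges, each lying on a different dark tile (so each dark tile contributes exactly one of its sides). A tiling-cycle is a self-avoiding cycle in $O_n(k)$ consisting of $T_n^k$ edges, each lying on a different dark tile. -}

module Defs where

-- Lattice points are pairs (a , b) of naturals, meaning the point a·e₁ + b·e₂
-- with e₁ = (1,0) and e₂ = (1/2, √3/2).  The big triangle of F_n(k) has side
-- N = n ^ k, corners (0,0), (N,0), (0,N).  Its centroid is (i+1/3, j+1/3),
-- so the centroid difference of two tiles equals their index difference.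

open import Data.Bool using (Bool; true; false; _∧_; _∨_; not; if_then_else_)
open import Data.Nat using (ℕ; zero; suc; _+_; _*_; _∸_; _^_; _≡ᵇ_; _<ᵇ_; _%_)
open import Data.Product using (_×_; _,_; proj₁; proj₂)
open import Data.List using (List; []; _∷_; _++_; map; concatMap; length; upTo; reverse; filterᵇ)
open import Data.Bool.ListAction using (any; all)
open import Data.Integer as ℤ using (ℤ; +_; -[1+_])
open import Relation.Nullary.Decidable using (⌊_⌋)

Point : Set
Point = ℕ × ℕ

Tile : Set
Tile = ℕ × ℕ

eqP : Point → Point → Bool
eqP (a , b) (c , d) = (a ≡ᵇ c) ∧ (b ≡ᵇ d)

ltP : Point → Point → Bool
ltP (a , b) (c , d) = (a <ᵇ c) ∨ ((a ≡ᵇ c) ∧ (b <ᵇ d))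

leqP : Point → Point → Bool
leqP p q = ltP p q ∨ eqP p q

elem : Point → List Point → Bool
elem x xs = any (eqP x) xs

nodup : List Point → Bool
nodup [] = true
nodup (x ∷ xs) = not (elem x xs) ∧ nodup xs

pairs : {A : Set} → List A → List (A × A)
pairs (x ∷ y ∷ r) = (x , y) ∷ pairs (y ∷ r)
pairs _ = []

cyclicPairs : {A : Set} → List A → List (A × A)
cyclicPairs [] = []
cyclicPairs (x ∷ r) = pairs ((x ∷ r) ++ (x ∷ []))

headIs : Point → List Point → Bool
headIs p [] = false
headIs p (x ∷ _) = eqP p x

lastIs : Point → List Point → Bool
lastIs p [] = false
lastIs p (x ∷ []) = eqP p x
lastIs p (_ ∷ y ∷ r) = lastIs p (y ∷ r)

-- canonical representative of a cycle (v₀ … v_{L-1}):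
-- v₀ is the lexicographically least vertex and v₁ < v_{L-1}.
-- Each cycle of length ≥ 3 has exactly one such vertex listing.
lastOr : Point → List Point → Point
lastOr d [] = d
lastOr d (x ∷ r) = lastOr x r

canonicalCycle : List Point → Bool
canonicalCycle [] = false
canonicalCycle (_ ∷ []) = false
canonicalCycle (v₀ ∷ v₁ ∷ r) =
  all (leqP v₀) (v₁ ∷ r) ∧ ltP v₁ (lastOr v₁ r)

listsOfLength : {A : Set} → List A → ℕ → List (List A)
listsOfLength cs zero = [] ∷ []
listsOfLength cs (suc l) = concatMap (λ c → map (c ∷_) (listsOfLength cs l)) cs

-- all lists over cs of length ≤ length cs (covers every duplicate-free list)
listsOver : {A : Set} → List A → List (List A)
listsOver cs = concatMap (listsOfLength cs) (upTo (suc (length cs)))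

count : {A : Set} → (A → Bool) → List A → ℕ
count P xs = length (filterᵇ P xs)

-- tile indices / lattice points in a box (duplicate-free supersets)
box : ℕ → List Point
box m = concatMap (λ a → map (λ b → (a , b)) (upTo m)) (upTo m)

T : ℕ → ℕ
T zero = 0
T (suc m) = suc m + T m

baseDark : ℕ → List Tile
baseDark n = concatMap (λ p → map (λ q → (p , q)) (upTo (n ∸ p))) (upTo n)

-- dark tiles of F_n(k) (with F_n(0) a single tile, so F_n(1) = F_n):
-- every dark tile (p,q) of F_n, scaled by n^k, is replaced by a copy of F_n(k)
darkTiles : ℕ → ℕ → List Tile
darkTiles n zero = (0 , 0) ∷ []
darkTiles n (suc k) =
  concatMap (λ pq → map (λ t → (proj₁ pq * n ^ k + proj₁ t , proj₂ pq * n ^ k + proj₂ t))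
                        (darkTiles n k))
            (baseDark n)

isDark : ℕ → ℕ → Tile → Bool
isDark n k t = elem t (darkTiles n k)

corners : Tile → List Point
corners (i , j) = (i , j) ∷ (suc i , j) ∷ (i , suc j) ∷ []

-- two distinct (upward) tiles share a point iff they share a corner
adjacentI : Tile → Tile → Bool
adjacentI t u = not (eqP t u) ∧ any (λ c → elem c (corners u)) (corners t)

eqZ : ℤ × ℤ → ℤ × ℤ → Bool
eqZ (a , b) (c , d) = ⌊ a ℤ.≟ c ⌋ ∧ ⌊ b ℤ.≟ d ⌋

-- direction code d (angle 60°·d) of a difference vector in the (e₁,e₂) basis:
-- e₁ ↦ 0, e₂ ↦ 1, e₂-e₁ ↦ 2, -e₁ ↦ 3, -e₂ ↦ 4, e₁-e₂ ↦ 5 (6 = not an edge)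
dirVec : ℤ × ℤ → ℕ
dirVec v =
  if eqZ v (+ 1 , + 0) then 0 else
  if eqZ v (+ 0 , + 1) then 1 else
  if eqZ v (-[1+ 0 ] , + 1) then 2 else
  if eqZ v (-[1+ 0 ] , + 0) then 3 else
  if eqZ v (+ 0 , -[1+ 0 ]) then 4 else
  if eqZ v (+ 1 , -[1+ 0 ]) then 5 else 6

dir : Tile × Tile → ℕ
dir ((i , j) , (i' , j')) = dirVec ((+ i') ℤ.- (+ i) , (+ j') ℤ.- (+ j))

isEven : ℕ → Bool
isEven d = d % 2 ≡ᵇ 0

okTurn : ℕ × ℕ → Bool
okTurn (d , e) =
  not (e ≡ᵇ (d + 3) % 6) ∧
  (if isEven d then not (e ≡ᵇ (d + 4) % 6) else not (e ≡ᵇ (d + 2) % 6))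

wfPath : List Tile → Bool
wfPath vs = all okTurn (pairs (map dir (pairs vs)))

wfCycle : List Tile → Bool
wfCycle vs = all okTurn (cyclicPairs (map dir (cyclicPairs vs)))

hamiltonianI : ℕ → ℕ → List Tile → Bool
hamiltonianI n k vs = nodup vs ∧ all (isDark n k) vs ∧ all (λ t → elem t vs) (darkTiles n k)

wfHamPath : ℕ → ℕ → List Tile → Bool
wfHamPath n k vs =
  hamiltonianI n k vs ∧ all (λ e → adjacentI (proj₁ e) (proj₂ e)) (pairs vs) ∧
  headIs (0 , 0) vs ∧ lastIs (n ^ k ∸ 1 , 0) vs ∧ wfPath vs

wfHamCycle : ℕ → ℕ → List Tile → Bool
wfHamCycle n k vs =
  hamiltonianI n k vs ∧ (3 <ᵇ suc (length vs)) ∧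
  all (λ e → adjacentI (proj₁ e) (proj₂ e)) (cyclicPairs vs) ∧
  (wfCycle vs ∨ wfCycle (reverse vs)) ∧ canonicalCycle vs

numWFHamPaths : ℕ → ℕ → ℕ
numWFHamPaths n k = count (wfHamPath n k) (listsOver (box (n ^ k)))

numWFHamCycles : ℕ → ℕ → ℕ
numWFHamCycles n k = count (wfHamCycle n k) (listsOver (box (n ^ k)))

isSideOf : Tile → Point × Point → Bool
isSideOf (i , j) (p , q) = any same sides
  where
  sides : List (Point × Point)
  sides = ((i , j) , (suc i , j)) ∷ ((i , j) , (i , suc j)) ∷ ((suc i , j) , (i , suc j)) ∷ []
  same : Point × Point → Bool
  same (a , b) = (eqP a p ∧ eqP b q) ∨ (eqP a q ∧ eqP b p)

edgeTiles : ℕ → ℕ → Point × Point → List Tile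
edgeTiles n k e = filterᵇ (λ t → isSideOf t e) (darkTiles n k)

nonEmpty : List Tile → Bool
nonEmpty [] = false
nonEmpty (_ ∷ _) = true

tilingEdges : ℕ → ℕ → List (Point × Point) → Bool
tilingEdges n k es = all (λ e → nonEmpty (edgeTiles n k e)) es ∧ nodup (concatMap (edgeTiles n k) es)

tilingPath : ℕ → ℕ → List Point → Bool
tilingPath n k ws =
  nodup ws ∧ tilingEdges n k (pairs ws) ∧ (length (pairs ws) ≡ᵇ T n ^ k) ∧
  headIs (0 , 0) ws ∧ lastIs (n ^ k , 0) ws

tilingCycle : ℕ → ℕ → List Point → Bool
tilingCycle n k ws =
  nodup ws ∧ (3 <ᵇ suc (length ws)) ∧ tilingEdges n k (cyclicPairs ws) ∧
  (length (cyclicPairs ws) ≡ᵇ T n ^ k) ∧ canonicalCycle ws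

numTilingPaths : ℕ → ℕ → ℕ
numTilingPaths n k = count (tilingPath n k) (listsOver (box (suc (n ^ k))))

numTilingCycles : ℕ → ℕ → ℕ
numTilingCycles n k = count (tilingCycle n k) (listsOver (box (suc (n ^ k))))

-- A well-formed Hamiltonian path t₀ … t_m of I_n^k corresponds to the sequence of points
-- (0,0), c₀₁, …, c_{m-1,m}, (N,0) of O_n(k), where c_{i,i+1} is the unique common corner of the
-- adjacent dark tiles t_i and t_{i+1}, and t_i contributes its side from c_{i-1,i} to c_{i,i+1}.
-- The turn conditions of well-formedness say exactly that every tile is entered and left through
-- different corners, i.e. that consecutive points differ, so these segments are sides; and since no
-- four upward tiles share a point, no point is repeated.  Conversely, each side of a tiling-path
-- lies on a unique dark tile, consecutive such tiles share the point between their sides and are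
-- therefore adjacent, and T_n^k distinct dark tiles are all of them.  Cycles are treated in the same
-- way after closing the walk up; there the two maps are inverse only up to rotation and reflection,
-- and they become exact inverses on the canonical listings by which both kinds of cycles are counted.

module Submission where

open import Defs renaming (T to triangular)
open import Data.Bool using (Bool; true; false; T; _∧_; _∨_; not)
open import Data.Bool.Properties using (T-∧; T-∨)
open import Data.Bool.ListAction using (any; all)
open import Data.Empty using (⊥; ⊥-elim)
import Data.Integer as ℤ
import Data.Integer.Properties as ℤ
open import Data.List
  using (List; []; _∷_; _++_; _∷ʳ_; [_]; head; initLast; _∷ʳ′_; applyUpTo; map; concatMap; length; upTo; reverse;
         filterᵇ; cartesianProduct)
open import Data.List.Properties
  using (length-++; length-map; length-upTo; length-reverse; map-++; map-∘; map-cong; map-cong-local; map-upTo;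
         ++-assoc; ++-identityʳ; reverse-map; reverse-++; unfold-reverse; reverse-involutive; ∷-injective)
open import Data.List.Membership.Propositional using (_∈_; _∉_; find; lose)
open import Data.List.Membership.Propositional.Properties
  using (∈-++⁺ˡ; ∈-++⁺ʳ; ∈-++⁻; ∈-map⁺; ∈-map⁻; ∈-∃++; ∈-concatMap⁺; ∈-concatMap⁻; ∈-filter⁺; ∈-filter⁻;
         ∈-upTo⁺; ∈-upTo⁻; ∈-cartesianProduct⁺)
open import Data.List.Relation.Binary.Permutation.Propositional using (_↭_; ↭-sym; ↭-trans; ↭⇒↭ₛ)
open import Data.List.Relation.Binary.Permutation.Propositional.Properties
  using (↭-reverse; All-resp-↭; ∈-resp-↭; ↭-length) renaming (++-comm to ↭-++-comm; shift to ↭-shift)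
import Data.List.Relation.Binary.Permutation.Setoid.Properties
open import Data.List.Relation.Binary.Subset.Propositional using (_⊆_)
open import Data.List.Relation.Unary.All as All using (All; []; _∷_)
import Data.List.Relation.Unary.All.Properties as All
open import Data.List.Relation.Unary.All.Properties using (¬Any⇒All¬; All¬⇒¬Any)
open import Data.List.Relation.Unary.AllPairs as AllPairs using ([]; _∷_)
import Data.List.Relation.Unary.AllPairs.Properties as AllPairs
open import Data.List.Relation.Unary.Any as Any using (Any; here; there)
open import Data.List.Relation.Unary.Any.Properties using (any⇔)
open import Data.List.Relation.Unary.Unique.Propositional using (Unique)
import Data.List.Relation.Unary.Unique.Propositional.Properties as Unique
open import Data.Maybe using (fromMaybe)
open import Data.Nat using (ℕ; zero; suc; _+_; _*_; _∸_; _^_; _≤_; _<_; _<ᵇ_; z≤n; s≤s)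
open import Data.Nat.ListAction using (sum)
open import Data.Nat.Properties using (≡ᵇ⇒≡; ≡⇒≡ᵇ)
import Data.Nat.Properties as ℕ
open import Data.Nat.Tactic.RingSolver using (solve-∀)
open import Data.Product using (∃; ∃₂; _×_; _,_; proj₁; proj₂; uncurry; swap)
import Data.Product as Product
open import Data.Product.Properties using (≡-dec)
open import Data.Product.Relation.Binary.Lex.Strict using (×-Lex; ×-asymmetric; ×-transitive; ×-compare)
open import Data.Product.Relation.Binary.Pointwise.NonDependent using (≡×≡⇒≡)
open import Data.Sum using (_⊎_; inj₁; inj₂; [_,_]′)
import Data.Sum
open import Data.Unit using (tt)
open import Function using (_∘_; id; _⇔_; mk⇔; Equivalence)
open import Relation.Binary.Definitions using (DecidableEquality; tri<; tri≈; tri>)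
open import Relation.Binary.PropositionalEquality
  using (_≡_; _≢_; refl; sym; trans; cong; cong₂; subst; subst₂; setoid; isEquivalence; resp₂; module ≡-Reasoning)
open import Relation.Nullary using (¬_; yes; no)
open import Relation.Nullary.Decidable using (⌊_⌋; toWitness; fromWitness; T?)

open Equivalence using (to; from)

_≟ₚ_ : DecidableEquality Point
_≟ₚ_ = ≡-dec ℕ._≟_ ℕ._≟_

-- Reading the Boolean definitions as propositions

T-eqP : ∀ {p q} → T (eqP p q) ⇔ p ≡ q
T-eqP {a , b} {c , d} = mk⇔
  (λ h → let a≡c , b≡d = to T-∧ h in cong₂ _,_ (≡ᵇ⇒≡ a c a≡c) (≡ᵇ⇒≡ b d b≡d))
  (λ { refl → from T-∧ (≡⇒≡ᵇ a a refl , ≡⇒≡ᵇ b b refl) })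

T-all : ∀ {A : Set} {p : A → Bool} {xs} → T (all p xs) ⇔ All (T ∘ p) xs
T-all {xs = []} = mk⇔ (λ _ → []) (λ _ → tt)
T-all {xs = x ∷ xs} = mk⇔
  (λ h → let px , pxs = to T-∧ h in px ∷ to T-all pxs)
  (λ { (px ∷ pxs) → from T-∧ (px , from T-all pxs) })

T-any : ∀ {A : Set} {p : A → Bool} {xs} → T (any p xs) ⇔ Any (T ∘ p) xs
T-any = mk⇔ (from any⇔) (to any⇔)

T-elem : ∀ {x xs} → T (elem x xs) ⇔ x ∈ xs
T-elem = mk⇔ (Any.map (to T-eqP) ∘ to T-any) (from T-any ∘ Any.map (from T-eqP))

T-not : ∀ {b} → T (not b) ⇔ (¬ T b)
T-not {true} = mk⇔ (λ ()) (λ ¬t → ¬t tt)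
T-not {false} = mk⇔ (λ _ ()) (λ _ → tt)

T-nodup : ∀ {xs} → T (nodup xs) ⇔ Unique xs
T-nodup {[]} = mk⇔ (λ _ → []) (λ _ → tt)
T-nodup {x ∷ xs} = mk⇔
  (λ h → let x∉xs , u = to T-∧ h in ¬Any⇒All¬ xs (to T-not x∉xs ∘ from T-elem) ∷ to T-nodup u)
  (λ { (x∉xs ∷ u) → from T-∧ (from T-not (All¬⇒¬Any x∉xs ∘ to T-elem) , from T-nodup u) })

T-3<ᵇ1+ : ∀ {m} → T (3 <ᵇ suc m) ⇔ 3 ≤ m
T-3<ᵇ1+ {m} = mk⇔ (ℕ.≤-pred ∘ ℕ.<ᵇ⇒< 3 (suc m)) (ℕ.<⇒<ᵇ ∘ s≤s)

-- Duplicate-free lists and counting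

module _ {A : Set} where

  Unique-length-≤ : ∀ {xs ys : List A} → Unique xs → xs ⊆ ys → length xs ≤ length ys
  Unique-length-≤ {[]} _ _ = z≤n
  Unique-length-≤ {x ∷ xs} (x∉xs ∷ u) xs⊆ys with ∈-∃++ (xs⊆ys (here refl))
  ... | as , bs , refl =
    subst (suc (length xs) ≤_) (sym (↭-length (↭-shift x as bs))) (s≤s (Unique-length-≤ u xs⊆as++bs))
    where
    xs⊆as++bs : xs ⊆ as ++ bs
    xs⊆as++bs y∈xs with ∈-++⁻ as (xs⊆ys (there y∈xs))
    ... | inj₁ y∈as = ∈-++⁺ˡ y∈as
    ... | inj₂ (here refl) = ⊥-elim (All.lookup x∉xs y∈xs refl)
    ... | inj₂ (there y∈bs) = ∈-++⁺ʳ as y∈bs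

  Unique-⊆-length⇒⊇ : DecidableEquality A → ∀ {xs ys : List A} →
    Unique xs → xs ⊆ ys → length ys ≤ length xs → ys ⊆ xs
  Unique-⊆-length⇒⊇ _≟_ {xs} {ys} u xs⊆ys |ys|≤|xs| {y} y∈ys with y ∈? xs
    where open import Data.List.Membership.DecPropositional _≟_ using (_∈?_)
  ... | yes y∈xs = y∈xs
  ... | no y∉xs = ⊥-elim (ℕ.<-irrefl refl
        (ℕ.≤-trans (Unique-length-≤ (¬Any⇒All¬ xs y∉xs ∷ u) y∷xs⊆ys) |ys|≤|xs|))
    where
    y∷xs⊆ys : y ∷ xs ⊆ ys
    y∷xs⊆ys (here refl) = y∈ys
    y∷xs⊆ys (there z∈xs) = xs⊆ys z∈xs

  Unique-map⁺-retraction : ∀ {B : Set} {xs : List A} (f : A → B) (g : B → A) →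
    (∀ {x} → x ∈ xs → g (f x) ≡ x) → Unique xs → Unique (map f xs)
  Unique-map⁺-retraction f g gf [] = []
  Unique-map⁺-retraction {xs = x ∷ xs} f g gf (x∉xs ∷ u) =
    All.map⁺ (All.tabulate (λ {y} y∈xs fx≡fy → All.lookup x∉xs y∈xs (x≡y y∈xs fx≡fy)))
      ∷ Unique-map⁺-retraction f g (gf ∘ there) u
    where
    x≡y : ∀ {y} → y ∈ xs → f x ≡ f y → x ≡ y
    x≡y y∈xs fx≡fy = trans (sym (gf (here refl))) (trans (cong g fx≡fy) (gf (there y∈xs)))

  Unique-concatMap⁺ : ∀ {B : Set} {xs : List A} (f : A → List B) → Unique xs → (∀ x → Unique (f x)) →
    (∀ {x y z} → z ∈ f x → z ∈ f y → x ≡ y) → Unique (concatMap f xs)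
  Unique-concatMap⁺ f u uf disjoint = Unique.concat⁺
    (All.map⁺ (All.universal uf _))
    (AllPairs.map⁺ (AllPairs.map (λ x≢y {_} (z∈fx , z∈fy) → x≢y (disjoint z∈fx z∈fy)) u))

  Unique-++⁻ˡ : ∀ (xs : List A) {ys} → Unique (xs ++ ys) → Unique xs
  Unique-++⁻ˡ [] _ = []
  Unique-++⁻ˡ (x ∷ xs) (x∉ ∷ u) = All.++⁻ˡ xs x∉ ∷ Unique-++⁻ˡ xs u

  Unique-singleton : ∀ {xs : List A} {t} → Unique xs → t ∈ xs → (∀ {y} → y ∈ xs → y ≡ t) → xs ≡ [ t ]
  Unique-singleton {x ∷ []} _ _ all≡t = cong [_] (all≡t (here refl))
  Unique-singleton {x ∷ y ∷ xs} (x∉ ∷ _) _ all≡t =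
    ⊥-elim (All.head x∉ (trans (all≡t (here refl)) (sym (all≡t (there (here refl))))))

module _ {A B : Set} where

  count-≤ : ∀ {P : A → Bool} {Q : B → Bool} {xs ys} (f : A → B) (g : B → A) → Unique xs →
    (∀ {x} → x ∈ xs → T (P x) → f x ∈ ys × T (Q (f x)) × g (f x) ≡ x) → count P xs ≤ count Q ys
  count-≤ {P} {Q} {xs} {ys} f g u into = subst (_≤ count Q ys) (length-map f (filterᵇ P xs))
    (Unique-length-≤ (Unique-map⁺-retraction f g (proj₂ ∘ proj₂ ∘ into′) (Unique.filter⁺ _ u)) mapped⊆)
    where
    into′ : ∀ {x} → x ∈ filterᵇ P xs → f x ∈ ys × T (Q (f x)) × g (f x) ≡ x
    into′ x∈ = let x∈xs , Px = ∈-filter⁻ _ x∈ in into x∈xs Px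
    mapped⊆ : map f (filterᵇ P xs) ⊆ filterᵇ Q ys
    mapped⊆ y∈ with ∈-map⁻ f y∈
    ... | x , x∈ , refl = let fx∈ys , Qfx , _ = into′ x∈ in ∈-filter⁺ _ fx∈ys Qfx

count-≡ : ∀ {A B : Set} {P : A → Bool} {Q : B → Bool} {xs ys} (f : A → B) (g : B → A) →
  Unique xs → Unique ys →
  (∀ {x} → x ∈ xs → T (P x) → f x ∈ ys × T (Q (f x)) × g (f x) ≡ x) →
  (∀ {y} → y ∈ ys → T (Q y) → g y ∈ xs × T (P (g y)) × f (g y) ≡ y) →
  count P xs ≡ count Q ys
count-≡ f g ux uy into back = ℕ.≤-antisym (count-≤ f g ux into) (count-≤ g f uy back)

-- Enumerations

module _ {A : Set} where

  length-∈-listsOfLength : ∀ (cs : List A) l {zs} → zs ∈ listsOfLength cs l → length zs ≡ l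
  length-∈-listsOfLength cs zero (here refl) = refl
  length-∈-listsOfLength cs (suc l) zs∈ with find (∈-concatMap⁻ _ {xs = cs} zs∈)
  ... | c , _ , zs∈′ with ∈-map⁻ (c ∷_) zs∈′
  ...   | ys , ys∈ , refl = cong suc (length-∈-listsOfLength cs l ys∈)

  listsOfLength-unique : ∀ {cs : List A} l → Unique cs → Unique (listsOfLength cs l)
  listsOfLength-unique zero _ = [] ∷ []
  listsOfLength-unique (suc l) u = Unique-concatMap⁺ _ u
    (λ c → Unique.map⁺ (proj₂ ∘ ∷-injective) (listsOfLength-unique l u))
    (λ z∈ z∈′ → let _ , _ , e = ∈-map⁻ _ z∈ ; _ , _ , e′ = ∈-map⁻ _ z∈′ in
      proj₁ (∷-injective (trans (sym e) e′)))

  ∈-listsOfLength⁺ : ∀ {cs xs : List A} → xs ⊆ cs → xs ∈ listsOfLength cs (length xs)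
  ∈-listsOfLength⁺ {xs = []} _ = here refl
  ∈-listsOfLength⁺ {xs = x ∷ xs} xs⊆cs =
    ∈-concatMap⁺ _ (lose (xs⊆cs (here refl)) (∈-map⁺ (x ∷_) (∈-listsOfLength⁺ (xs⊆cs ∘ there))))

  listsOver-unique : ∀ {cs : List A} → Unique cs → Unique (listsOver cs)
  listsOver-unique {cs} u =
    Unique-concatMap⁺ (listsOfLength cs) (Unique.upTo⁺ (suc (length cs))) (λ l → listsOfLength-unique l u)
      (λ {l} {l′} z∈ z∈′ → trans (sym (length-∈-listsOfLength cs l z∈)) (length-∈-listsOfLength cs l′ z∈′))

  ∈-listsOver⁺ : ∀ {cs xs : List A} → Unique xs → xs ⊆ cs → xs ∈ listsOver cs
  ∈-listsOver⁺ {cs} u xs⊆cs =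
    ∈-concatMap⁺ (listsOfLength cs) (lose (∈-upTo⁺ (s≤s (Unique-length-≤ u xs⊆cs))) (∈-listsOfLength⁺ xs⊆cs))

box≡cartesianProduct : ∀ m → box m ≡ cartesianProduct (upTo m) (upTo m)
box≡cartesianProduct m = go (upTo m)
  where
  go : ∀ as → concatMap (λ a → map (λ b → (a , b)) (upTo m)) as ≡ cartesianProduct as (upTo m)
  go [] = refl
  go (a ∷ as) = cong (map (a ,_) (upTo m) ++_) (go as)

box-unique : ∀ m → Unique (box m)
box-unique m = subst Unique (sym (box≡cartesianProduct m))
  (Unique.cartesianProduct⁺ (Unique.upTo⁺ m) (Unique.upTo⁺ m))

∈-box⁺ : ∀ {m a b} → a < m → b < m → (a , b) ∈ box m
∈-box⁺ {m} a<m b<m = subst (_ ∈_) (sym (box≡cartesianProduct m))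
  (∈-cartesianProduct⁺ (∈-upTo⁺ a<m) (∈-upTo⁺ b<m))

-- Consecutive pairs, rotations and reflections

module _ {A : Set} where

  pairs-∷ʳ : ∀ (xs : List A) y z → pairs ((xs ∷ʳ y) ∷ʳ z) ≡ pairs (xs ∷ʳ y) ∷ʳ (y , z)
  pairs-∷ʳ [] y z = refl
  pairs-∷ʳ (x ∷ []) y z = refl
  pairs-∷ʳ (x ∷ x′ ∷ xs) y z = cong ((x , x′) ∷_) (pairs-∷ʳ (x′ ∷ xs) y z)

  pairs-map : ∀ {B : Set} (f : A → B) xs → pairs (map f xs) ≡ map (Product.map f f) (pairs xs)
  pairs-map f [] = refl
  pairs-map f (x ∷ []) = refl
  pairs-map f (x ∷ y ∷ xs) = cong ((f x , f y) ∷_) (pairs-map f (y ∷ xs))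

  pairs-reverse : ∀ (xs : List A) → pairs (reverse xs) ≡ map swap (reverse (pairs xs))
  pairs-reverse [] = refl
  pairs-reverse (x ∷ []) = refl
  pairs-reverse (x ∷ y ∷ xs) = begin
    pairs (reverse (x ∷ y ∷ xs))
      ≡⟨ cong pairs (trans (unfold-reverse x (y ∷ xs)) (cong (_∷ʳ x) (unfold-reverse y xs))) ⟩
    pairs ((reverse xs ∷ʳ y) ∷ʳ x)
      ≡⟨ pairs-∷ʳ (reverse xs) y x ⟩
    pairs (reverse xs ∷ʳ y) ∷ʳ (y , x)
      ≡⟨ cong (λ ps → pairs ps ∷ʳ (y , x)) (sym (unfold-reverse y xs)) ⟩
    pairs (reverse (y ∷ xs)) ∷ʳ (y , x)
      ≡⟨ cong (_∷ʳ (y , x)) (pairs-reverse (y ∷ xs)) ⟩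
    map swap (reverse (pairs (y ∷ xs))) ∷ʳ (y , x)
      ≡⟨ sym (map-++ swap (reverse (pairs (y ∷ xs))) [ (x , y) ]) ⟩
    map swap (reverse (pairs (y ∷ xs)) ∷ʳ (x , y))
      ≡⟨ cong (map swap) (sym (unfold-reverse (x , y) (pairs (y ∷ xs)))) ⟩
    map swap (reverse (pairs (x ∷ y ∷ xs)))
      ∎
    where open ≡-Reasoning

  length-pairs : ∀ (x : A) xs → length (pairs (x ∷ xs)) ≡ length xs
  length-pairs x [] = refl
  length-pairs x (y ∷ xs) = cong suc (length-pairs y xs)

  length-cyclicPairs : ∀ (xs : List A) → length (cyclicPairs xs) ≡ length xs
  length-cyclicPairs [] = refl
  length-cyclicPairs (x ∷ xs) = trans (length-pairs x (xs ∷ʳ x)) (trans (length-++ xs) (ℕ.+-comm (length xs) 1))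

  ∈-pairs⁻ : ∀ {xs : List A} {a b} → (a , b) ∈ pairs xs → a ∈ xs × b ∈ xs
  ∈-pairs⁻ {x ∷ y ∷ xs} (here refl) = here refl , there (here refl)
  ∈-pairs⁻ {x ∷ y ∷ xs} (there ab∈) = let a∈ , b∈ = ∈-pairs⁻ ab∈ in there a∈ , there b∈

  All-pairs-++⁻ˡ : ∀ {P : A × A → Set} xs {ys} → All P (pairs (xs ++ ys)) → All P (pairs xs)
  All-pairs-++⁻ˡ [] _ = []
  All-pairs-++⁻ˡ (x ∷ []) _ = []
  All-pairs-++⁻ˡ (x ∷ y ∷ xs) (p ∷ ps) = p ∷ All-pairs-++⁻ˡ (y ∷ xs) ps

  Unique⇒pairs-≢ : ∀ {xs : List A} → Unique xs → All (uncurry _≢_) (pairs xs)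
  Unique⇒pairs-≢ {[]} _ = []
  Unique⇒pairs-≢ {x ∷ []} _ = []
  Unique⇒pairs-≢ {x ∷ y ∷ xs} (x∉ ∷ u) = All.head x∉ ∷ Unique⇒pairs-≢ u

  Unique⇒cyclicPairs-≢ : ∀ {x : A} {xs} → Unique (x ∷ xs) → 1 ≤ length xs → All (uncurry _≢_) (cyclicPairs (x ∷ xs))
  Unique⇒cyclicPairs-≢ {x} {xs} u _ with xs | initLast xs
  ... | .(ys ∷ʳ z) | ys ∷ʳ′ z = subst (All (uncurry _≢_)) (sym (pairs-∷ʳ (x ∷ ys) z x))
    (All.++⁺ (Unique⇒pairs-≢ u) ((λ z≡x → All.lookup (AllPairs.head u) (∈-++⁺ʳ ys (here refl)) (sym z≡x)) ∷ []))

pairs-∷ʳ-lastOr : ∀ (x : Point) xs z → pairs ((x ∷ xs) ∷ʳ z) ≡ pairs (x ∷ xs) ∷ʳ (lastOr x xs , z)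
pairs-∷ʳ-lastOr x [] z = refl
pairs-∷ʳ-lastOr x (y ∷ xs) z = cong ((x , y) ∷_) (pairs-∷ʳ-lastOr y xs z)

lastOr-∷ʳ : ∀ d xs (x : Point) → lastOr d (xs ∷ʳ x) ≡ x
lastOr-∷ʳ d [] x = refl
lastOr-∷ʳ d (y ∷ xs) x = lastOr-∷ʳ y xs x

rotate : ∀ {A : Set} → List A → List A
rotate [] = []
rotate (x ∷ xs) = xs ∷ʳ x

map-rotate : ∀ {A B : Set} (f : A → B) xs → map f (rotate xs) ≡ rotate (map f xs)
map-rotate f [] = refl
map-rotate f (x ∷ xs) = map-++ f xs [ x ]

module _ {A : Set} where

  cyclicPairs-rotate : ∀ (xs : List A) → cyclicPairs (rotate xs) ≡ rotate (cyclicPairs xs)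
  cyclicPairs-rotate [] = refl
  cyclicPairs-rotate (x ∷ []) = refl
  cyclicPairs-rotate (x ∷ y ∷ xs) = pairs-∷ʳ (y ∷ xs) x y

  cyclicPairs-reverse : ∀ (xs : List A) → cyclicPairs (reverse xs) ≡ rotate (map swap (reverse (cyclicPairs xs)))
  cyclicPairs-reverse xs with initLast xs
  ... | [] = refl
  ... | ys ∷ʳ′ z = begin
    cyclicPairs (reverse (ys ∷ʳ z))             ≡⟨ cong cyclicPairs (reverse-++ ys [ z ]) ⟩
    pairs ((z ∷ reverse ys) ∷ʳ z)               ≡⟨ cong (λ zs → pairs (zs ∷ʳ z)) (sym (reverse-++ ys [ z ])) ⟩
    pairs (reverse (ys ∷ʳ z) ∷ʳ z)              ≡⟨ cong pairs (sym (unfold-reverse z (ys ∷ʳ z))) ⟩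
    pairs (reverse (z ∷ ys ∷ʳ z))               ≡⟨ pairs-reverse (z ∷ ys ∷ʳ z) ⟩
    map swap (reverse (pairs (z ∷ ys ∷ʳ z)))    ≡⟨ closing ys ⟩
    rotate (map swap (reverse (cyclicPairs (ys ∷ʳ z)))) ∎
    where
    open ≡-Reasoning
    closing : ∀ ys → map swap (reverse (pairs (z ∷ ys ∷ʳ z))) ≡ rotate (map swap (reverse (cyclicPairs (ys ∷ʳ z))))
    closing [] = refl
    closing (y ∷ ys) = begin
      map swap (reverse ((z , y) ∷ ps))
        ≡⟨ cong (map swap) (unfold-reverse (z , y) ps) ⟩
      map swap (reverse ps ∷ʳ (z , y))
        ≡⟨ map-++ swap (reverse ps) [ (z , y) ] ⟩
      rotate ((y , z) ∷ map swap (reverse ps))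
        ≡⟨ cong (rotate ∘ map swap) (sym (reverse-++ ps [ (z , y) ])) ⟩
      rotate (map swap (reverse (ps ∷ʳ (z , y))))
        ≡⟨ cong (rotate ∘ map swap ∘ reverse) (sym (pairs-∷ʳ (y ∷ ys) z y)) ⟩
      rotate (map swap (reverse (cyclicPairs (y ∷ ys ∷ʳ z))))
        ∎
      where ps = pairs (y ∷ ys ∷ʳ z)

  Rotation : List A → List A → Set
  Rotation xs ys = ∃₂ λ p s → xs ≡ p ++ s × ys ≡ s ++ p

  Rotation-refl : ∀ {xs} → Rotation xs xs
  Rotation-refl {xs} = [] , xs , refl , sym (++-identityʳ xs)

  Rotation-sym : ∀ {xs ys} → Rotation xs ys → Rotation ys xs
  Rotation-sym (p , s , xs≡ , ys≡) = s , p , ys≡ , xs≡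

  private
    ++-split : ∀ (p s p′ s′ : List A) → p ++ s ≡ p′ ++ s′ →
      (∃ λ m → p′ ≡ p ++ m × s ≡ m ++ s′) ⊎ (∃ λ m → p ≡ p′ ++ m × s′ ≡ m ++ s)
    ++-split [] s p′ s′ eq = inj₁ (p′ , refl , eq)
    ++-split (x ∷ p) s [] s′ eq = inj₂ (x ∷ p , refl , sym eq)
    ++-split (x ∷ p) s (y ∷ p′) s′ eq with ∷-injective eq
    ... | refl , eq′ with ++-split p s p′ s′ eq′
    ...   | inj₁ (m , e₁ , e₂) = inj₁ (m , cong (x ∷_) e₁ , e₂)
    ...   | inj₂ (m , e₁ , e₂) = inj₂ (m , cong (x ∷_) e₁ , e₂)

  Rotation-trans : ∀ {xs ys zs} → Rotation xs ys → Rotation ys zs → Rotation xs zs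
  Rotation-trans (p , s , refl , e) (p′ , s′ , e′ , refl) with ++-split s p p′ s′ (trans (sym e) e′)
  ... | inj₁ (m , refl , refl) = m , s′ ++ s , ++-assoc m s′ s , sym (++-assoc s′ s m)
  ... | inj₂ (m , refl , refl) = p ++ p′ , m , sym (++-assoc p p′ m) , ++-assoc m p p′

  Rotation-rotate : ∀ xs → Rotation xs (rotate xs)
  Rotation-rotate [] = Rotation-refl
  Rotation-rotate (x ∷ xs) = [ x ] , xs , refl , refl

  Rotation-reverse : ∀ {xs ys} → Rotation xs ys → Rotation (reverse xs) (reverse ys)
  Rotation-reverse (p , s , refl , refl) = reverse s , reverse p , reverse-++ p s , reverse-++ s p

  Rotation-∷-unique : ∀ {m : A} {t t′} → m ∉ t → Rotation (m ∷ t) (m ∷ t′) → t ≡ t′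
  Rotation-∷-unique _ (p , [] , e , e′) = proj₂ (∷-injective (trans e (trans (++-identityʳ p) (sym e′))))
  Rotation-∷-unique {t = t} _ ([] , s , refl , e′) = sym (trans (proj₂ (∷-injective e′)) (++-identityʳ t))
  Rotation-∷-unique m∉t (y ∷ p , x ∷ s , e , e′) with ∷-injective e | ∷-injective e′
  ... | refl , t≡ | refl , _ = ⊥-elim (m∉t (subst (_ ∈_) (sym t≡) (∈-++⁺ʳ p (here refl))))

Rotation-map : ∀ {A B : Set} (F : List A → List B) → (∀ xs → F (rotate xs) ≡ rotate (F xs)) →
  ∀ {xs ys} → Rotation xs ys → Rotation (F xs) (F ys)
Rotation-map F F-rotate (p , s , refl , refl) = go p s
  where
  go : ∀ p s → Rotation (F (p ++ s)) (F (s ++ p))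
  go [] s = subst (Rotation (F s) ∘ F) (sym (++-identityʳ s)) Rotation-refl
  go (a ∷ p) s = Rotation-trans
    (subst (Rotation (F (a ∷ p ++ s))) (sym (F-rotate (a ∷ p ++ s))) (Rotation-rotate (F (a ∷ p ++ s))))
    (subst₂ (λ u v → Rotation (F u) (F v)) (sym (++-assoc p s [ a ])) (++-assoc s [ a ] p) (go p (s ∷ʳ a)))

SameCycle : ∀ {A : Set} → List A → List A → Set
SameCycle xs ys = Rotation xs ys ⊎ Rotation (reverse xs) ys

module _ {A : Set} where

  SameCycle-refl : ∀ {xs : List A} → SameCycle xs xs
  SameCycle-refl = inj₁ Rotation-refl

  SameCycle-rotate : ∀ (xs : List A) → SameCycle xs (rotate xs)
  SameCycle-rotate xs = inj₁ (Rotation-rotate xs)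

  SameCycle-reverse : ∀ (xs : List A) → SameCycle xs (reverse xs)
  SameCycle-reverse xs = inj₂ Rotation-refl

  private
    Rotation-reverseˡ : ∀ {xs ys : List A} → Rotation (reverse xs) ys → Rotation xs (reverse ys)
    Rotation-reverseˡ {xs} r = subst (λ zs → Rotation zs _) (reverse-involutive xs) (Rotation-reverse r)

  SameCycle-sym : ∀ {xs ys : List A} → SameCycle xs ys → SameCycle ys xs
  SameCycle-sym (inj₁ r) = inj₁ (Rotation-sym r)
  SameCycle-sym (inj₂ r) = inj₂ (Rotation-sym (Rotation-reverseˡ r))

  SameCycle-trans : ∀ {xs ys zs : List A} → SameCycle xs ys → SameCycle ys zs → SameCycle xs zs
  SameCycle-trans (inj₁ r) (inj₁ r′) = inj₁ (Rotation-trans r r′)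
  SameCycle-trans (inj₁ r) (inj₂ r′) = inj₂ (Rotation-trans (Rotation-reverse r) r′)
  SameCycle-trans (inj₂ r) (inj₁ r′) = inj₂ (Rotation-trans r r′)
  SameCycle-trans (inj₂ r) (inj₂ r′) = inj₁ (Rotation-trans (Rotation-reverseˡ r) r′)

  SameCycle⇒↭ : ∀ {xs ys : List A} → SameCycle xs ys → xs ↭ ys
  SameCycle⇒↭ (inj₁ (p , s , refl , refl)) = ↭-++-comm p s
  SameCycle⇒↭ {xs} (inj₂ (p , s , e , refl)) =
    ↭-trans (↭-sym (↭-reverse xs)) (subst (_↭ s ++ p) (sym e) (↭-++-comm p s))

  SameCycle-∈ : ∀ {xs ys : List A} {x} → SameCycle xs ys → x ∈ xs → x ∈ ys
  SameCycle-∈ c = ∈-resp-↭ (SameCycle⇒↭ c)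

  SameCycle-unique : ∀ {xs ys : List A} → SameCycle xs ys → Unique xs → Unique ys
  SameCycle-unique c = Permutationₛ.Unique-resp-↭ (↭⇒↭ₛ (SameCycle⇒↭ c))
    where module Permutationₛ = Data.List.Relation.Binary.Permutation.Setoid.Properties (setoid A)

  SameCycle-length : ∀ {xs ys : List A} → SameCycle xs ys → length ys ≡ length xs
  SameCycle-length c = sym (↭-length (SameCycle⇒↭ c))

module _ {A : Set} where

  ∈-cyclicPairs-SameCycle : ∀ {xs ys : List A} → SameCycle xs ys →
    ∀ {e} → e ∈ cyclicPairs ys → e ∈ cyclicPairs xs ⊎ swap e ∈ cyclicPairs xs
  ∈-cyclicPairs-SameCycle (inj₁ r) e∈ =
    inj₁ (SameCycle-∈ (SameCycle-sym (inj₁ (Rotation-map cyclicPairs cyclicPairs-rotate r))) e∈)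
  ∈-cyclicPairs-SameCycle {xs} (inj₂ r) e∈
    with ∈-map⁻ swap (SameCycle-∈ (SameCycle-sym (SameCycle-rotate _)) (subst (_ ∈_) (cyclicPairs-reverse xs)
           (SameCycle-∈ (SameCycle-sym (inj₁ (Rotation-map cyclicPairs cyclicPairs-rotate r))) e∈)))
  ... | (a , b) , e′∈ , refl = inj₂ (∈-resp-↭ (↭-reverse (cyclicPairs xs)) e′∈)

  All-cyclicPairs-SameCycle : ∀ {P : A × A → Set} → (∀ {e} → P e → P (swap e)) →
    ∀ {xs ys} → SameCycle xs ys → All P (cyclicPairs xs) → All P (cyclicPairs ys)
  All-cyclicPairs-SameCycle P-swap c ps =
    All.tabulate λ e∈ → [ All.lookup ps , P-swap ∘ All.lookup ps ]′ (∈-cyclicPairs-SameCycle c e∈)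

  map-cyclicPairs-rotate : ∀ {B : Set} (F : A × A → B) xs →
    map F (cyclicPairs (rotate xs)) ≡ rotate (map F (cyclicPairs xs))
  map-cyclicPairs-rotate F xs = trans (cong (map F) (cyclicPairs-rotate xs)) (map-rotate F (cyclicPairs xs))

  SameCycle-map-cyclicPairs : ∀ {B : Set} (F : A × A → B) {xs ys} → (∀ {e} → e ∈ cyclicPairs xs → F (swap e) ≡ F e) →
    SameCycle xs ys → SameCycle (map F (cyclicPairs xs)) (map F (cyclicPairs ys))
  SameCycle-map-cyclicPairs F F-swap (inj₁ r) = inj₁ (Rotation-map (map F ∘ cyclicPairs) (map-cyclicPairs-rotate F) r)
  SameCycle-map-cyclicPairs F {xs} F-swap (inj₂ r) = inj₂ (Rotation-trans
    (subst (Rotation _) (sym reversed) (Rotation-rotate _))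
    (Rotation-map (map F ∘ cyclicPairs) (map-cyclicPairs-rotate F) r))
    where
    cp : List (A × A)
    cp = cyclicPairs xs
    reversed : map F (cyclicPairs (reverse xs)) ≡ rotate (reverse (map F cp))
    reversed = begin
      map F (cyclicPairs (reverse xs))        ≡⟨ cong (map F) (cyclicPairs-reverse xs) ⟩
      map F (rotate (map swap (reverse cp)))  ≡⟨ map-rotate F (map swap (reverse cp)) ⟩
      rotate (map F (map swap (reverse cp)))  ≡⟨ cong rotate (sym (map-∘ (reverse cp))) ⟩
      rotate (map (F ∘ swap) (reverse cp))    ≡⟨ cong rotate (map-cong-local (All.tabulate F-swap′)) ⟩
      rotate (map F (reverse cp))             ≡⟨ cong rotate (reverse-map F cp) ⟩
      rotate (reverse (map F cp))             ∎
      where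
      open ≡-Reasoning
      F-swap′ : ∀ {e} → e ∈ reverse cp → F (swap e) ≡ F e
      F-swap′ = F-swap ∘ ∈-resp-↭ (↭-reverse cp)

-- Canonical listings of cycles

_<ₗ_ : Point → Point → Set
_<ₗ_ = ×-Lex _≡_ _<_ _<_

_≤ₗ_ : Point → Point → Set
p ≤ₗ q = p <ₗ q ⊎ p ≡ q

T-ltP : ∀ {p q} → T (ltP p q) ⇔ p <ₗ q
T-ltP {a , b} {c , d} = mk⇔
  (λ h → [ inj₁ ∘ ℕ.<ᵇ⇒< a c
         , (λ h′ → let a≡c , b<d = to T-∧ h′ in inj₂ (≡ᵇ⇒≡ a c a≡c , ℕ.<ᵇ⇒< b d b<d)) ]′ (to T-∨ h))
  (λ { (inj₁ a<c) → from T-∨ (inj₁ (ℕ.<⇒<ᵇ a<c))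
     ; (inj₂ (refl , b<d)) → from T-∨ (inj₂ (from T-∧ (≡⇒≡ᵇ a a refl , ℕ.<⇒<ᵇ b<d))) })

T-leqP : ∀ {p q} → T (leqP p q) ⇔ p ≤ₗ q
T-leqP = mk⇔ (Data.Sum.map (to T-ltP) (to T-eqP) ∘ to T-∨) (from T-∨ ∘ Data.Sum.map (from T-ltP) (from T-eqP))

<ₗ-asym : ∀ {p q} → p <ₗ q → ¬ q <ₗ p
<ₗ-asym = ×-asymmetric {_≈₁_ = _≡_} {_<₁_ = _<_} {_<₂_ = _<_} sym (resp₂ _<_) ℕ.<-asym ℕ.<-asym

<ₗ-irrefl : ∀ {p} → ¬ p <ₗ p
<ₗ-irrefl p<p = <ₗ-asym p<p p<p

<ₗ-trans : ∀ {p q r} → p <ₗ q → q <ₗ r → p <ₗ r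
<ₗ-trans = ×-transitive {_≈₁_ = _≡_} {_<₁_ = _<_} {_<₂_ = _<_} isEquivalence (resp₂ _<_) ℕ.<-trans ℕ.<-trans

<ₗ-connex : ∀ {p q} → p ≢ q → p <ₗ q ⊎ q <ₗ p
<ₗ-connex {p} {q} p≢q with ×-compare sym ℕ.<-cmp ℕ.<-cmp p q
... | tri< p<q _ _ = inj₁ p<q
... | tri≈ _ p≈q _ = ⊥-elim (p≢q (≡×≡⇒≡ p≈q))
... | tri> _ _ q<p = inj₂ q<p

≤ₗ-antisym : ∀ {p q} → p ≤ₗ q → q ≤ₗ p → p ≡ q
≤ₗ-antisym (inj₂ p≡q) _ = p≡q
≤ₗ-antisym (inj₁ _) (inj₂ q≡p) = sym q≡p
≤ₗ-antisym (inj₁ p<q) (inj₁ q<p) = ⊥-elim (<ₗ-asym p<q q<p)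

≤ₗ-trans : ∀ {p q r} → p ≤ₗ q → q ≤ₗ r → p ≤ₗ r
≤ₗ-trans (inj₂ refl) q≤r = q≤r
≤ₗ-trans (inj₁ p<q) (inj₂ refl) = inj₁ p<q
≤ₗ-trans (inj₁ p<q) (inj₁ q<r) = inj₁ (<ₗ-trans p<q q<r)

≤ₗ-total : ∀ p q → p ≤ₗ q ⊎ q ≤ₗ p
≤ₗ-total p q with p ≟ₚ q
... | yes p≡q = inj₁ (inj₂ p≡q)
... | no p≢q = Data.Sum.map inj₁ inj₁ (<ₗ-connex p≢q)

minimum : ∀ (x : Point) xs → ∃ λ m → m ∈ x ∷ xs × All (m ≤ₗ_) (x ∷ xs)
minimum x [] = x , here refl , inj₂ refl ∷ []
minimum x (y ∷ xs) with minimum y xs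
... | m , m∈ , m≤ with ≤ₗ-total x m
...   | inj₁ x≤m = x , here refl , inj₂ refl ∷ All.map (≤ₗ-trans x≤m) m≤
...   | inj₂ m≤x = m , there m∈ , m≤x ∷ m≤

Oriented : List Point → Set
Oriented [] = ⊥
Oriented (v ∷ vs) = v <ₗ lastOr v vs

Canonical : List Point → Set
Canonical [] = ⊥
Canonical (m ∷ vs) = All (m ≤ₗ_) vs × Oriented vs

T-canonicalCycle : ∀ {xs} → T (canonicalCycle xs) ⇔ Canonical xs
T-canonicalCycle {[]} = mk⇔ (λ ()) (λ ())
T-canonicalCycle {m ∷ []} = mk⇔ (λ ()) proj₂
T-canonicalCycle {m ∷ v ∷ vs} = mk⇔
  (λ h → let m≤ , o = to T-∧ h in All.map (to T-leqP) (to T-all m≤) , to T-ltP o)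
  (λ (m≤ , o) → from T-∧ (from T-all (All.map (from T-leqP) m≤) , from T-ltP o))

reverse-∷-∷ʳ : ∀ {A : Set} (v : A) ys z → reverse (v ∷ ys ∷ʳ z) ≡ z ∷ reverse ys ∷ʳ v
reverse-∷-∷ʳ v ys z = trans (unfold-reverse v (ys ∷ʳ z)) (cong (_∷ʳ v) (reverse-++ ys [ z ]))

Rotation-reverse-∷ : ∀ {A : Set} (m : A) vs → Rotation (reverse (m ∷ vs)) (m ∷ reverse vs)
Rotation-reverse-∷ m vs = reverse vs , [ m ] , unfold-reverse m vs , refl

Oriented-reverse : ∀ {xs} → Oriented xs → ¬ Oriented (reverse xs)
Oriented-reverse {v ∷ vs} o with initLast vs
... | [] = λ _ → <ₗ-irrefl o
... | ys ∷ʳ′ z = λ o′ → <ₗ-asym (subst (v <ₗ_) (lastOr-∷ʳ v ys z) o)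
  (subst (z <ₗ_) (lastOr-∷ʳ z (reverse ys) v) (subst Oriented (reverse-∷-∷ʳ v ys z) o′))

orient : Point → List Point → List Point
orient m [] = [ m ]
orient m (v ∷ vs) with ltP v (lastOr v vs)
... | true = m ∷ v ∷ vs
... | false = m ∷ reverse (v ∷ vs)

orient-canonical : ∀ {m} vs → Unique vs → 2 ≤ length vs → All (m ≤ₗ_) vs →
  Canonical (orient m vs) × SameCycle (m ∷ vs) (orient m vs)
orient-canonical (v ∷ vs) u 2≤ m≤ with initLast vs
... | [] = ⊥-elim (ℕ.<-irrefl refl 2≤)
... | ys ∷ʳ′ z with ltP v (lastOr v (ys ∷ʳ z)) in lt
...   | true = (m≤ , to T-ltP (subst T (sym lt) tt)) , SameCycle-refl
...   | false = (All-resp-↭ (↭-sym (↭-reverse (v ∷ ys ∷ʳ z))) m≤ , oriented)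
              , inj₂ (Rotation-reverse-∷ _ (v ∷ ys ∷ʳ z))
  where
  v≢z : v ≢ z
  v≢z = All.lookup (AllPairs.head u) (∈-++⁺ʳ ys (here refl))
  z<v : z <ₗ v
  z<v = [ (λ v<z → ⊥-elim (subst T lt (from T-ltP (subst (v <ₗ_) (sym (lastOr-∷ʳ v ys z)) v<z)))) , id ]′
        (<ₗ-connex v≢z)
  oriented : Oriented (reverse (v ∷ ys ∷ʳ z))
  oriented = subst Oriented (sym (reverse-∷-∷ʳ v ys z)) (subst (z <ₗ_) (sym (lastOr-∷ʳ z (reverse ys) v)) z<v)

canonicalForm : List Point → List Point
canonicalForm [] = []
canonicalForm (x ∷ xs) with minimum x xs
... | m , m∈ , _ with ∈-∃++ m∈
...   | p , s , _ = orient m (s ++ p)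

canonicalForm-spec : ∀ {xs} → Unique xs → 3 ≤ length xs → Canonical (canonicalForm xs) × SameCycle xs (canonicalForm xs)
canonicalForm-spec {x ∷ xs} u 3≤ with minimum x xs
... | m , m∈ , m≤ with ∈-∃++ m∈
...   | p , s , split = Product.map₂ (SameCycle-trans rotated)
  (orient-canonical (s ++ p) (AllPairs.tail (SameCycle-unique rotated u)) 2≤
    (All.tabulate (All.lookup m≤ ∘ SameCycle-∈ (SameCycle-sym rotated) ∘ there)))
  where
  rotated : SameCycle (x ∷ xs) (m ∷ s ++ p)
  rotated = inj₁ (p , m ∷ s , split , refl)
  2≤ : 2 ≤ length (s ++ p)
  2≤ = ℕ.≤-pred (subst (3 ≤_) (sym (SameCycle-length rotated)) 3≤)

Canonical-unique : ∀ {xs ys} → Unique xs → Canonical xs → Canonical ys → SameCycle xs ys → xs ≡ ys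
Canonical-unique {m ∷ t} {m′ ∷ t′} (m∉t ∷ u) (m≤ , o) (m′≤ , o′) c
  with ≤ₗ-antisym (least m≤ (SameCycle-∈ (SameCycle-sym c) (here refl))) (least m′≤ (SameCycle-∈ c (here refl)))
  where
  least : ∀ {m t y} → All (m ≤ₗ_) t → y ∈ m ∷ t → m ≤ₗ y
  least _ (here refl) = inj₂ refl
  least m≤ (there y∈) = All.lookup m≤ y∈
... | refl with c
...   | inj₁ r = cong (m ∷_) (Rotation-∷-unique (All¬⇒¬Any m∉t) r)
...   | inj₂ r = ⊥-elim (Oriented-reverse o
        (subst Oriented (sym (Rotation-∷-unique m∉rt (Rotation-trans (Rotation-sym (Rotation-reverse-∷ m t)) r))) o′))
  where
  m∉rt : m ∉ reverse t
  m∉rt = All¬⇒¬Any m∉t ∘ ∈-resp-↭ (↭-reverse t)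

canonicalForm-unique : ∀ {xs ys} → Unique xs → 3 ≤ length xs → Canonical ys → SameCycle xs ys → canonicalForm xs ≡ ys
canonicalForm-unique u 3≤ canonical c with canonicalForm-spec u 3≤
... | form , same = Canonical-unique (SameCycle-unique same u) form canonical (SameCycle-trans (SameCycle-sym same) c)

record CycleProperty : Set₁ where
  field
    Holds  : List Point → Set
    resp   : ∀ {xs ys} → SameCycle xs ys → Holds xs → Holds ys
    unique : ∀ {xs} → Holds xs → Unique xs
    long   : ∀ {xs} → Holds xs → 3 ≤ length xs

open CycleProperty using (Holds)

-- Maps that are mutually inverse up to rotation and reflection become exactly inverse
-- once composed with canonicalForm.
canonical-round-trip : ∀ (P Q : CycleProperty) (f g : List Point → List Point) →
  (∀ {xs} → Holds P xs → Holds Q (f xs)) →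
  (∀ {xs ys} → Holds Q xs → SameCycle xs ys → SameCycle (g xs) (g ys)) →
  (∀ {xs} → Holds P xs → SameCycle (g (f xs)) xs) →
  ∀ {xs} → Holds P xs → Canonical xs →
  Holds Q (canonicalForm (f xs)) × Canonical (canonicalForm (f xs)) × SameCycle (f xs) (canonicalForm (f xs)) ×
  canonicalForm (g (canonicalForm (f xs))) ≡ xs
canonical-round-trip P Q f g f-Q g-resp g∘f {xs} Pxs canonical =
  Q.resp same Qf , form , same , canonicalForm-unique (P.unique Pgc) (P.long Pgc) canonical back
  where
  module P = CycleProperty P
  module Q = CycleProperty Q
  Qf : Holds Q (f xs)
  Qf = f-Q Pxs
  form : Canonical (canonicalForm (f xs))
  form = proj₁ (canonicalForm-spec (Q.unique Qf) (Q.long Qf))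
  same : SameCycle (f xs) (canonicalForm (f xs))
  same = proj₂ (canonicalForm-spec (Q.unique Qf) (Q.long Qf))
  back : SameCycle (g (canonicalForm (f xs))) xs
  back = SameCycle-trans (SameCycle-sym (g-resp Qf same)) (g∘f Pxs)
  Pgc : Holds P (g (canonicalForm (f xs)))
  Pgc = P.resp (SameCycle-sym back) Pxs

-- Corners, adjacency, turns and sides of upward tiles

data Vertex : Set where
  bottomLeft bottomRight apex : Vertex

vertex : Tile → Vertex → Point
vertex (i , j) bottomLeft = (i , j)
vertex (i , j) bottomRight = (suc i , j)
vertex (i , j) apex = (i , suc j)

data Corner : Point → Tile → Set where
  bottomLeft : ∀ {i j} → Corner (i , j) (i , j)
  bottomRight : ∀ {i j} → Corner (suc i , j) (i , j)
  apex : ∀ {i j} → Corner (i , suc j) (i , j)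

Corner-vertex : ∀ t v → Corner (vertex t v) t
Corner-vertex t bottomLeft = bottomLeft
Corner-vertex t bottomRight = bottomRight
Corner-vertex t apex = apex

vertex-injective : ∀ t {v w} → vertex t v ≡ vertex t w → v ≡ w
vertex-injective t {bottomLeft} {bottomLeft} _ = refl
vertex-injective t {bottomRight} {bottomRight} _ = refl
vertex-injective t {apex} {apex} _ = refl
vertex-injective t {bottomLeft} {bottomRight} ()
vertex-injective t {bottomLeft} {apex} ()
vertex-injective t {bottomRight} {bottomLeft} ()
vertex-injective t {bottomRight} {apex} ()
vertex-injective t {apex} {bottomLeft} ()
vertex-injective t {apex} {bottomRight} ()

_≟ᵛ_ : DecidableEquality Vertex
bottomLeft ≟ᵛ bottomLeft = yes refl
bottomRight ≟ᵛ bottomRight = yes refl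
apex ≟ᵛ apex = yes refl
bottomLeft ≟ᵛ bottomRight = no λ ()
bottomLeft ≟ᵛ apex = no λ ()
bottomRight ≟ᵛ bottomLeft = no λ ()
bottomRight ≟ᵛ apex = no λ ()
apex ≟ᵛ bottomLeft = no λ ()
apex ≟ᵛ bottomRight = no λ ()

∈-corners⇔Corner : ∀ {c t} → c ∈ corners t ⇔ Corner c t
∈-corners⇔Corner = mk⇔
  (λ { (here refl) → bottomLeft ; (there (here refl)) → bottomRight ; (there (there (here refl))) → apex })
  (λ { bottomLeft → here refl ; bottomRight → there (here refl) ; apex → there (there (here refl)) })

-- Lists every upward tile with corner (a , b); at the border, truncated subtraction
-- merely repeats (a , b).
cornerTiles : Point → List Tile
cornerTiles (a , b) = (a , b) ∷ (a ∸ 1 , b) ∷ (a , b ∸ 1) ∷ []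

Corner⇒∈-cornerTiles : ∀ {c t} → Corner c t → t ∈ cornerTiles c
Corner⇒∈-cornerTiles bottomLeft = here refl
Corner⇒∈-cornerTiles bottomRight = there (here refl)
Corner⇒∈-cornerTiles apex = there (there (here refl))

no-four-tiles-at-a-corner : ∀ {c a b x y} → Corner c a → Corner c b → Corner c x → Corner c y →
  ¬ Unique (a ∷ b ∷ x ∷ y ∷ [])
no-four-tiles-at-a-corner ca cb cx cy u = ℕ.<-irrefl refl (Unique-length-≤ u
  (λ { (here refl) → Corner⇒∈-cornerTiles ca
     ; (there (here refl)) → Corner⇒∈-cornerTiles cb
     ; (there (there (here refl))) → Corner⇒∈-cornerTiles cx
     ; (there (there (there (here refl)))) → Corner⇒∈-cornerTiles cy }))

data Adjacent : Tile → Tile → Set where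
  adj₀ : ∀ {i j} → Adjacent (i , j) (suc i , j)
  adj₁ : ∀ {i j} → Adjacent (i , j) (i , suc j)
  adj₂ : ∀ {i j} → Adjacent (suc i , j) (i , suc j)
  adj₃ : ∀ {i j} → Adjacent (suc i , j) (i , j)
  adj₄ : ∀ {i j} → Adjacent (i , suc j) (i , j)
  adj₅ : ∀ {i j} → Adjacent (i , suc j) (suc i , j)

direction : ∀ {t u} → Adjacent t u → ℕ
direction adj₀ = 0
direction adj₁ = 1
direction adj₂ = 2
direction adj₃ = 3
direction adj₄ = 4
direction adj₅ = 5

Adjacent-sym : ∀ {t u} → Adjacent t u → Adjacent u t
Adjacent-sym adj₀ = adj₃
Adjacent-sym adj₁ = adj₄
Adjacent-sym adj₂ = adj₅
Adjacent-sym adj₃ = adj₀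
Adjacent-sym adj₄ = adj₁
Adjacent-sym adj₅ = adj₂

Adjacent⇒≢ : ∀ {t u} → Adjacent t u → t ≢ u
Adjacent⇒≢ adj₀ ()
Adjacent⇒≢ adj₁ ()
Adjacent⇒≢ adj₂ ()
Adjacent⇒≢ adj₃ ()
Adjacent⇒≢ adj₄ ()
Adjacent⇒≢ adj₅ ()

common-Corner⇒Adjacent : ∀ {c t u} → Corner c t → Corner c u → t ≢ u → Adjacent t u
common-Corner⇒Adjacent bottomLeft bottomLeft t≢u = ⊥-elim (t≢u refl)
common-Corner⇒Adjacent bottomLeft bottomRight _ = adj₃
common-Corner⇒Adjacent bottomLeft apex _ = adj₄
common-Corner⇒Adjacent bottomRight bottomLeft _ = adj₀
common-Corner⇒Adjacent bottomRight bottomRight t≢u = ⊥-elim (t≢u refl)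
common-Corner⇒Adjacent bottomRight apex _ = adj₅
common-Corner⇒Adjacent apex bottomLeft _ = adj₁
common-Corner⇒Adjacent apex bottomRight _ = adj₂
common-Corner⇒Adjacent apex apex t≢u = ⊥-elim (t≢u refl)

private
  i-i≡0 : ∀ i → ℤ.+ i ℤ.- ℤ.+ i ≡ ℤ.+ 0
  i-i≡0 i = trans (ℤ.[+m]-[+n]≡m⊖n i i) (ℤ.n⊖n≡0 i)

  [1+i]-i≡1 : ∀ i → ℤ.+ suc i ℤ.- ℤ.+ i ≡ ℤ.+ 1
  [1+i]-i≡1 i = trans (ℤ.[+m]-[+n]≡m⊖n (suc i) i) (trans (ℤ.⊖-≥ (ℕ.n≤1+n i)) (cong ℤ.+_ (ℕ.m+n∸n≡m 1 i)))

  i-[1+i]≡-1 : ∀ i → ℤ.+ i ℤ.- ℤ.+ suc i ≡ ℤ.-[1+ 0 ]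
  i-[1+i]≡-1 i = trans (ℤ.[+m]-[+n]≡m⊖n i (suc i))
    (trans (ℤ.⊖-swap i (suc i)) (cong ℤ.-_ (trans (sym (ℤ.[+m]-[+n]≡m⊖n (suc i) i)) ([1+i]-i≡1 i))))

dir-Adjacent : ∀ {t u} (a : Adjacent t u) → dir (t , u) ≡ direction a
dir-Adjacent (adj₀ {i} {j}) rewrite [1+i]-i≡1 i | i-i≡0 j = refl
dir-Adjacent (adj₁ {i} {j}) rewrite i-i≡0 i | [1+i]-i≡1 j = refl
dir-Adjacent (adj₂ {i} {j}) rewrite i-[1+i]≡-1 i | [1+i]-i≡1 j = refl
dir-Adjacent (adj₃ {i} {j}) rewrite i-[1+i]≡-1 i | i-i≡0 j = refl
dir-Adjacent (adj₄ {i} {j}) rewrite i-i≡0 i | i-[1+i]≡-1 j = refl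
dir-Adjacent (adj₅ {i} {j}) rewrite [1+i]-i≡1 i | i-[1+i]≡-1 j = refl

-- The vertex of the target (resp. source) tile at which a step in direction d enters (resp. leaves).
entryVertex exitVertex : ℕ → Vertex
entryVertex 0 = bottomLeft
entryVertex 1 = bottomLeft
entryVertex 2 = bottomRight
entryVertex 3 = bottomRight
entryVertex _ = apex
exitVertex 0 = bottomRight
exitVertex 1 = apex
exitVertex 2 = apex
exitVertex 3 = bottomLeft
exitVertex 4 = bottomLeft
exitVertex _ = bottomRight

sharedCorner : Tile → Tile → Point
sharedCorner t u = vertex u (entryVertex (dir (t , u)))

sharedCorner-entry : ∀ {t u} (a : Adjacent t u) → sharedCorner t u ≡ vertex u (entryVertex (direction a))
sharedCorner-entry {t} {u} a = cong (vertex u ∘ entryVertex) (dir-Adjacent a)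

sharedCorner-exit : ∀ {t u} (a : Adjacent t u) → sharedCorner t u ≡ vertex t (exitVertex (direction a))
sharedCorner-exit a = trans (sharedCorner-entry a) (entry≡exit a)
  where
  entry≡exit : ∀ {t u} (a : Adjacent t u) → vertex u (entryVertex (direction a)) ≡ vertex t (exitVertex (direction a))
  entry≡exit adj₀ = refl
  entry≡exit adj₁ = refl
  entry≡exit adj₂ = refl
  entry≡exit adj₃ = refl
  entry≡exit adj₄ = refl
  entry≡exit adj₅ = refl

Corner-sharedCornerˡ : ∀ {t u} → Adjacent t u → Corner (sharedCorner t u) t
Corner-sharedCornerˡ {t} a = subst (λ c → Corner c t) (sym (sharedCorner-exit a)) (Corner-vertex t _)

Corner-sharedCornerʳ : ∀ {t u} → Adjacent t u → Corner (sharedCorner t u) u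
Corner-sharedCornerʳ {u = u} a = subst (λ c → Corner c u) (sym (sharedCorner-entry a)) (Corner-vertex u _)

common-Corner-unique : ∀ {c t u} → Adjacent t u → Corner c t → Corner c u → c ≡ sharedCorner t u
common-Corner-unique a ct cu = trans (at-entry a ct cu) (sym (sharedCorner-entry a))
  where
  at-entry : ∀ {c t u} (a : Adjacent t u) → Corner c t → Corner c u → c ≡ vertex u (entryVertex (direction a))
  at-entry adj₀ bottomRight bottomLeft = refl
  at-entry adj₁ apex bottomLeft = refl
  at-entry adj₂ apex bottomRight = refl
  at-entry adj₃ bottomLeft bottomRight = refl
  at-entry adj₄ bottomLeft apex = refl
  at-entry adj₅ bottomRight apex = refl

sharedCorner≡common-Corner : ∀ {r t t′} → Corner r t → Corner r t′ → t ≢ t′ → sharedCorner t t′ ≡ r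
sharedCorner≡common-Corner cr cr′ t≢t′ = sym (common-Corner-unique (common-Corner⇒Adjacent cr cr′ t≢t′) cr cr′)

sharedCorner-sym : ∀ {t u} → Adjacent t u → sharedCorner t u ≡ sharedCorner u t
sharedCorner-sym a = common-Corner-unique (Adjacent-sym a) (Corner-sharedCornerʳ a) (Corner-sharedCornerˡ a)

-- The paper's turn conditions, checked direction by direction: a turn is allowed exactly
-- when the step into a tile and the step out of it use different vertices of that tile.
okTurn-vertices : ∀ {a b b′ c} (α : Adjacent a b) (β : Adjacent b′ c) →
  okTurn (direction α , direction β) ≡ not ⌊ entryVertex (direction α) ≟ᵛ exitVertex (direction β) ⌋
okTurn-vertices adj₀ adj₀ = refl
okTurn-vertices adj₀ adj₁ = refl
okTurn-vertices adj₀ adj₂ = refl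
okTurn-vertices adj₀ adj₃ = refl
okTurn-vertices adj₀ adj₄ = refl
okTurn-vertices adj₀ adj₅ = refl
okTurn-vertices adj₁ adj₀ = refl
okTurn-vertices adj₁ adj₁ = refl
okTurn-vertices adj₁ adj₂ = refl
okTurn-vertices adj₁ adj₃ = refl
okTurn-vertices adj₁ adj₄ = refl
okTurn-vertices adj₁ adj₅ = refl
okTurn-vertices adj₂ adj₀ = refl
okTurn-vertices adj₂ adj₁ = refl
okTurn-vertices adj₂ adj₂ = refl
okTurn-vertices adj₂ adj₃ = refl
okTurn-vertices adj₂ adj₄ = refl
okTurn-vertices adj₂ adj₅ = refl
okTurn-vertices adj₃ adj₀ = refl
okTurn-vertices adj₃ adj₁ = refl
okTurn-vertices adj₃ adj₂ = refl
okTurn-vertices adj₃ adj₃ = refl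
okTurn-vertices adj₃ adj₄ = refl
okTurn-vertices adj₃ adj₅ = refl
okTurn-vertices adj₄ adj₀ = refl
okTurn-vertices adj₄ adj₁ = refl
okTurn-vertices adj₄ adj₂ = refl
okTurn-vertices adj₄ adj₃ = refl
okTurn-vertices adj₄ adj₄ = refl
okTurn-vertices adj₄ adj₅ = refl
okTurn-vertices adj₅ adj₀ = refl
okTurn-vertices adj₅ adj₁ = refl
okTurn-vertices adj₅ adj₂ = refl
okTurn-vertices adj₅ adj₃ = refl
okTurn-vertices adj₅ adj₄ = refl
okTurn-vertices adj₅ adj₅ = refl

T-okTurn : ∀ {a b c} (α : Adjacent a b) (β : Adjacent b c) →
  T (okTurn (dir (a , b) , dir (b , c))) ⇔ sharedCorner a b ≢ sharedCorner b c
T-okTurn {a} {b} {c} α β = mk⇔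
  (λ ok same → to T-not (subst T okTurn≡ ok) (fromWitness (vertex-injective b
     (trans (sym (sharedCorner-entry α)) (trans same (sharedCorner-exit β))))))
  (λ distinct → subst T (sym okTurn≡) (from T-not (λ same → distinct
     (trans (sharedCorner-entry α) (trans (cong (vertex b) (toWitness same)) (sym (sharedCorner-exit β)))))))
  where
  okTurn≡ : okTurn (dir (a , b) , dir (b , c)) ≡ not ⌊ entryVertex (direction α) ≟ᵛ exitVertex (direction β) ⌋
  okTurn≡ = trans (cong okTurn (cong₂ _,_ (dir-Adjacent α) (dir-Adjacent β))) (okTurn-vertices α β)

T-adjacentI : ∀ {t u} → T (adjacentI t u) ⇔ Adjacent t u
T-adjacentI {t} {u} = mk⇔
  (λ h → let t≢u , shared = to T-∧ h ; c , c∈t , c∈u = find (to (T-any {p = sharesCorner}) shared) in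
    common-Corner⇒Adjacent (to ∈-corners⇔Corner c∈t) (to ∈-corners⇔Corner (to T-elem c∈u)) (to T-not t≢u ∘ from T-eqP))
  (λ a → from T-∧ (from T-not (Adjacent⇒≢ a ∘ to T-eqP) , from (T-any {p = sharesCorner})
    (lose (from ∈-corners⇔Corner (Corner-sharedCornerˡ a)) (from T-elem (from ∈-corners⇔Corner (Corner-sharedCornerʳ a))))))
  where
  sharesCorner : Point → Bool
  sharesCorner c = elem c (corners u)

matchesSide : Point × Point → Point × Point → Bool
matchesSide (a , b) (p , q) = (eqP a p ∧ eqP b q) ∨ (eqP a q ∧ eqP b p)

T-matchesSide : ∀ {a b p q} → T (matchesSide (a , b) (p , q)) ⇔ ((a ≡ p × b ≡ q) ⊎ (a ≡ q × b ≡ p))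
T-matchesSide {a} {b} {p} {q} = mk⇔
  (Data.Sum.map both both ∘ to (T-∨ {eqP a p ∧ eqP b q} {eqP a q ∧ eqP b p}))
  (from (T-∨ {eqP a p ∧ eqP b q} {eqP a q ∧ eqP b p}) ∘ Data.Sum.map both⁻¹ both⁻¹)
  where
  both : ∀ {a b p q} → T (eqP a p ∧ eqP b q) → a ≡ p × b ≡ q
  both {a} {b} {p} {q} h =
    let a≡p , b≡q = to (T-∧ {eqP a p} {eqP b q}) h in to (T-eqP {a} {p}) a≡p , to (T-eqP {b} {q}) b≡q
  both⁻¹ : ∀ {a b p q} → a ≡ p × b ≡ q → T (eqP a p ∧ eqP b q)
  both⁻¹ {a} {b} {p} {q} (a≡p , b≡q) =
    from (T-∧ {eqP a p} {eqP b q}) (from (T-eqP {a} {p}) a≡p , from (T-eqP {b} {q}) b≡q)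

sides : Tile → List (Point × Point)
sides t = (vertex t bottomLeft , vertex t bottomRight) ∷ (vertex t bottomLeft , vertex t apex)
        ∷ (vertex t bottomRight , vertex t apex) ∷ []

isSideOf≡any-sides : ∀ t e → isSideOf t e ≡ any (λ s → matchesSide s e) (sides t)
isSideOf≡any-sides (i , j) (p , q) = refl

T-isSideOf : ∀ {t p q} → T (isSideOf t (p , q)) ⇔ (Corner p t × Corner q t × p ≢ q)
T-isSideOf {t} {p} {q} = mk⇔
  (sound ∘ to (T-any {p = λ s → matchesSide s (p , q)}) ∘ subst T (isSideOf≡any-sides t (p , q)))
  (subst T (sym (isSideOf≡any-sides t (p , q))) ∘ from (T-any {p = λ s → matchesSide s (p , q)}) ∘ complete)
  where
  matching : ∀ {t p q v w} → v ≢ w → T (matchesSide (vertex t v , vertex t w) (p , q)) →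
    Corner p t × Corner q t × p ≢ q
  matching {t} {p} {q} {v} {w} v≢w h with to (T-matchesSide {vertex t v} {vertex t w} {p} {q}) h
  ... | inj₁ (refl , refl) = Corner-vertex t v , Corner-vertex t w , v≢w ∘ vertex-injective t
  ... | inj₂ (refl , refl) = Corner-vertex t w , Corner-vertex t v , v≢w ∘ vertex-injective t ∘ sym
  sound : ∀ {t p q} → Any (λ s → T (matchesSide s (p , q))) (sides t) → Corner p t × Corner q t × p ≢ q
  sound (here h) = matching {v = bottomLeft} {bottomRight} (λ ()) h
  sound (there (here h)) = matching {v = bottomLeft} {apex} (λ ()) h
  sound (there (there (here h))) = matching {v = bottomRight} {apex} (λ ()) h
  forward : ∀ a b → T (matchesSide (a , b) (a , b))
  forward a b = from (T-matchesSide {a} {b} {a} {b}) (inj₁ (refl , refl))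
  backward : ∀ a b → T (matchesSide (a , b) (b , a))
  backward a b = from (T-matchesSide {a} {b} {b} {a}) (inj₂ (refl , refl))
  complete : ∀ {t p q} → Corner p t × Corner q t × p ≢ q → Any (λ s → T (matchesSide s (p , q))) (sides t)
  complete (bottomLeft , bottomLeft , p≢q) = ⊥-elim (p≢q refl)
  complete {t} (bottomLeft , bottomRight , _) = here (forward (vertex t bottomLeft) (vertex t bottomRight))
  complete {t} (bottomRight , bottomLeft , _) = here (backward (vertex t bottomLeft) (vertex t bottomRight))
  complete {t} (bottomLeft , apex , _) = there (here (forward (vertex t bottomLeft) (vertex t apex)))
  complete {t} (apex , bottomLeft , _) = there (here (backward (vertex t bottomLeft) (vertex t apex)))
  complete (bottomRight , bottomRight , p≢q) = ⊥-elim (p≢q refl)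
  complete {t} (bottomRight , apex , _) = there (there (here (forward (vertex t bottomRight) (vertex t apex))))
  complete {t} (apex , bottomRight , _) = there (there (here (backward (vertex t bottomRight) (vertex t apex))))
  complete (apex , apex , p≢q) = ⊥-elim (p≢q refl)

side-unique : ∀ {t u e} → T (isSideOf t e) → T (isSideOf u e) → t ≡ u
side-unique {t} {u} {p , q} side-t side-u with t ≟ₚ u | to (T-isSideOf {t}) side-t | to (T-isSideOf {u}) side-u
... | yes t≡u | _ | _ = t≡u
... | no t≢u | pt , qt , p≢q | pu , qu , _ =
  ⊥-elim (p≢q (trans (common-Corner-unique a pt pu) (sym (common-Corner-unique a qt qu))))
  where a = common-Corner⇒Adjacent pt pu t≢u

-- The dark tiles of F_n(k)

length-concatMap : ∀ {A B : Set} (f : A → List B) xs → length (concatMap f xs) ≡ sum (map (length ∘ f) xs)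
length-concatMap f [] = refl
length-concatMap f (x ∷ xs) = trans (length-++ (f x)) (cong (length (f x) +_) (length-concatMap f xs))

length-concatMap-const : ∀ {A B : Set} (f : A → List B) xs {l} → (∀ x → length (f x) ≡ l) →
  length (concatMap f xs) ≡ length xs * l
length-concatMap-const f [] _ = refl
length-concatMap-const f (x ∷ xs) |f|≡l =
  trans (length-++ (f x)) (cong₂ _+_ (|f|≡l x) (length-concatMap-const f xs |f|≡l))

sum-applyUpTo-∸ : ∀ n → sum (applyUpTo (n ∸_) n) ≡ triangular n
sum-applyUpTo-∸ zero = refl
sum-applyUpTo-∸ (suc n) = cong (suc n +_) (sum-applyUpTo-∸ n)

baseDark-length : ∀ n → length (baseDark n) ≡ triangular n
baseDark-length n = begin
  length (baseDark n)
    ≡⟨ length-concatMap _ (upTo n) ⟩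
  sum (map (λ p → length (map (p ,_) (upTo (n ∸ p)))) (upTo n))
    ≡⟨ cong sum (map-cong (λ p → trans (length-map (p ,_) (upTo (n ∸ p))) (length-upTo (n ∸ p))) (upTo n)) ⟩
  sum (map (n ∸_) (upTo n))
    ≡⟨ cong sum (map-upTo (n ∸_) n) ⟩
  sum (applyUpTo (n ∸_) n)
    ≡⟨ sum-applyUpTo-∸ n ⟩
  triangular n
    ∎
  where open ≡-Reasoning

darkTiles-length : ∀ n k → length (darkTiles n k) ≡ triangular n ^ k
darkTiles-length n zero = refl
darkTiles-length n (suc k) = trans (length-concatMap-const _ (baseDark n) (λ _ → length-map _ (darkTiles n k)))
  (cong₂ _*_ (baseDark-length n) (darkTiles-length n k))

∈-baseDark⁻ : ∀ n {p q} → (p , q) ∈ baseDark n → p + q < n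
∈-baseDark⁻ n p,q∈ with find (∈-concatMap⁻ _ {xs = upTo n} p,q∈)
... | p , p∈ , q∈ with ∈-map⁻ (p ,_) q∈
...   | q , q∈′ , refl = subst (p + q <_) (ℕ.m+[n∸m]≡n (ℕ.<⇒≤ (∈-upTo⁻ p∈))) (ℕ.+-monoʳ-< p (∈-upTo⁻ q∈′))

[p*s+a]+[q*s+b]≡[p+q]*s+[a+b] : ∀ p q a b s → (p * s + a) + (q * s + b) ≡ (p + q) * s + (a + b)
[p*s+a]+[q*s+b]≡[p+q]*s+[a+b] = solve-∀

p*s+a<[1+p]*s : ∀ p {s a} → a < s → p * s + a < suc p * s
p*s+a<[1+p]*s p {s} {a} a<s = subst (p * s + a <_) (ℕ.+-comm (p * s) s) (ℕ.+-monoʳ-< (p * s) a<s)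

darkTiles-bound : ∀ n k {t} → t ∈ darkTiles n k → proj₁ t + proj₂ t < n ^ k
darkTiles-bound n zero (here refl) = s≤s z≤n
darkTiles-bound n (suc k) t∈ with find (∈-concatMap⁻ _ {xs = baseDark n} t∈)
... | (p , q) , p,q∈ , t∈′ with ∈-map⁻ _ t∈′
...   | (a , b) , a,b∈ , refl = begin-strict
  (p * s + a) + (q * s + b)   ≡⟨ [p*s+a]+[q*s+b]≡[p+q]*s+[a+b] p q a b s ⟩
  (p + q) * s + (a + b)       <⟨ p*s+a<[1+p]*s (p + q) (darkTiles-bound n k a,b∈) ⟩
  suc (p + q) * s             ≤⟨ ℕ.*-monoˡ-≤ s (∈-baseDark⁻ n p,q∈) ⟩
  n * s                       ∎
  where
  s : ℕ
  s = n ^ k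
  open ℕ.≤-Reasoning

darkTiles-coordinates : ∀ n k {a b} → (a , b) ∈ darkTiles n k → a < n ^ k × b < n ^ k
darkTiles-coordinates n k {a} {b} t∈ = ℕ.≤-<-trans (ℕ.m≤m+n a b) bound , ℕ.≤-<-trans (ℕ.m≤n+m b a) bound
  where bound = darkTiles-bound n k t∈

*+-injectiveˡ : ∀ s p p′ {a a′} → a < s → a′ < s → p * s + a ≡ p′ * s + a′ → p ≡ p′
*+-injectiveˡ s p p′ a<s a′<s eq with ℕ.<-cmp p p′
... | tri< p<p′ _ _ = ⊥-elim (ℕ.<-irrefl eq (below p<p′ a<s))
  where
  below : ∀ {p p′ a a′} → p < p′ → a < s → p * s + a < p′ * s + a′
  below {p} {p′} {a′ = a′} p<p′ a<s = ℕ.<-≤-trans (p*s+a<[1+p]*s p a<s)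
    (ℕ.≤-trans (ℕ.*-monoˡ-≤ s p<p′) (ℕ.m≤m+n (p′ * s) a′))
... | tri≈ _ p≡p′ _ = p≡p′
... | tri> _ _ p′<p = ⊥-elim (ℕ.<-irrefl (sym eq) (ℕ.<-≤-trans (p*s+a<[1+p]*s p′ a′<s)
        (ℕ.≤-trans (ℕ.*-monoˡ-≤ s p′<p) (ℕ.m≤m+n (p * s) _))))

baseDark-unique : ∀ n → Unique (baseDark n)
baseDark-unique n = Unique-concatMap⁺ _ (Unique.upTo⁺ n) (λ p → Unique.map⁺ (cong proj₂) (Unique.upTo⁺ (n ∸ p)))
  (λ z∈ z∈′ → let _ , _ , e = ∈-map⁻ _ z∈ ; _ , _ , e′ = ∈-map⁻ _ z∈′ in cong proj₁ (trans (sym e) e′))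

darkTiles-unique : ∀ n k → Unique (darkTiles n k)
darkTiles-unique n zero = [] ∷ []
darkTiles-unique n (suc k) =
  Unique-concatMap⁺ _ (baseDark-unique n) (λ o → Unique.map⁺ (shift-injective {o}) (darkTiles-unique n k)) same-block
  where
  s : ℕ
  s = n ^ k
  shift : Tile → Tile → Tile
  shift (p , q) (a , b) = (p * s + a , q * s + b)
  shift-injective : ∀ {o t t′} → shift o t ≡ shift o t′ → t ≡ t′
  shift-injective {p , q} e =
    cong₂ _,_ (ℕ.+-cancelˡ-≡ (p * s) _ _ (cong proj₁ e)) (ℕ.+-cancelˡ-≡ (q * s) _ _ (cong proj₂ e))
  same-block : ∀ {o o′ z} → z ∈ map (shift o) (darkTiles n k) → z ∈ map (shift o′) (darkTiles n k) → o ≡ o′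
  same-block z∈ z∈′ with ∈-map⁻ _ z∈ | ∈-map⁻ _ z∈′
  ... | _ , t∈ , refl | _ , t′∈ , e with darkTiles-coordinates n k t∈ | darkTiles-coordinates n k t′∈
  ...   | a<s , b<s | a′<s , b′<s =
    cong₂ _,_ (*+-injectiveˡ s _ _ a<s a′<s (cong proj₁ e)) (*+-injectiveˡ s _ _ b<s b′<s (cong proj₂ e))

-- Chains of points along tiles

joints : List Tile → List Point
joints ts = map (uncurry sharedCorner) (pairs ts)

cycleJoints : List Tile → List Point
cycleJoints ts = map (uncurry sharedCorner) (cyclicPairs ts)

data Chain : List Point → List Tile → Set where
  end : ∀ {p} → Chain [ p ] []
  step : ∀ {p q ps t ts} → Corner p t → Corner q t → Chain (q ∷ ps) ts → Chain (p ∷ q ∷ ps) (t ∷ ts)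

Chain-length : ∀ {ps ts} → Chain ps ts → length (pairs ps) ≡ length ts
Chain-length end = refl
Chain-length (step _ _ c) = cong suc (Chain-length c)

Chain-last : ∀ {p ps t ts} → Chain (p ∷ ps) (t ∷ ts) → Corner (lastOr p ps) (lastOr t ts)
Chain-last (step _ cq end) = cq
Chain-last (step _ _ c@(step _ _ _)) = Chain-last c

Chain-∷ʳ : ∀ {p ps ts t q} → Chain (p ∷ ps) ts → Corner (lastOr p ps) t → Corner q t →
  Chain ((p ∷ ps) ∷ʳ q) (ts ∷ʳ t)
Chain-∷ʳ end cl cq = step cl cq end
Chain-∷ʳ (step cp cq′ c) cl cq = step cp cq′ (Chain-∷ʳ c cl cq)

Chain-corners : ∀ {ps t ts} → Chain ps (t ∷ ts) → ∀ {w} → w ∈ ps → ∃ λ u → u ∈ t ∷ ts × Corner w u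
Chain-corners (step cp _ _) (here refl) = _ , here refl , cp
Chain-corners (step _ cq end) (there (here refl)) = _ , here refl , cq
Chain-corners (step _ _ c@(step _ _ _)) (there w∈) = let u , u∈ , cw = Chain-corners c w∈ in u , there u∈ , cw

Chain-adjacent : ∀ {ps ts} → Chain ps ts → All (uncurry _≢_) (pairs ts) → All (uncurry Adjacent) (pairs ts)
Chain-adjacent end _ = []
Chain-adjacent (step _ _ end) _ = []
Chain-adjacent (step _ cq c@(step cq′ _ _)) (t≢t′ ∷ ≢s) = common-Corner⇒Adjacent cq cq′ t≢t′ ∷ Chain-adjacent c ≢s

Chain-joints : ∀ {p q} ps {ts} → Chain (p ∷ ps ∷ʳ q) ts → All (uncurry _≢_) (pairs ts) → joints ts ≡ ps
Chain-joints [] (step _ _ end) _ = refl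
Chain-joints (r ∷ []) (step _ cr c@(step cr′ _ _)) (t≢t′ ∷ ≢s) =
  cong₂ _∷_ (sharedCorner≡common-Corner cr cr′ t≢t′) (Chain-joints [] c ≢s)
Chain-joints (r ∷ r′ ∷ ps) (step _ cr c@(step cr′ _ _)) (t≢t′ ∷ ≢s) =
  cong₂ _∷_ (sharedCorner≡common-Corner cr cr′ t≢t′) (Chain-joints (r′ ∷ ps) c ≢s)

joints-Chain : ∀ {p q t} ts → All (uncurry Adjacent) (pairs (t ∷ ts)) → Corner p t → Corner q (lastOr t ts) →
  Chain (p ∷ joints (t ∷ ts) ∷ʳ q) (t ∷ ts)
joints-Chain [] _ cp cq = step cp cq end
joints-Chain (t′ ∷ ts) (a ∷ adj) cp cq = step cp (Corner-sharedCornerˡ a) (joints-Chain ts adj (Corner-sharedCornerʳ a) cq)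

joints-unique : ∀ {ts} → Unique ts → All (uncurry Adjacent) (pairs ts) → All (uncurry _≢_) (pairs (joints ts)) →
  Unique (joints ts)
joints-unique {[]} _ _ _ = []
joints-unique {_ ∷ []} _ _ _ = []
joints-unique {_ ∷ _ ∷ []} _ _ _ = [] ∷ []
joints-unique {a ∷ b ∷ c ∷ r} (a∉ ∷ u@(b∉ ∷ _)) (ab ∷ adj@(_ ∷ adj′)) (j≢j′ ∷ ≢s) =
  (j≢j′ ∷ All.map⁺ (All.tabulate apart)) ∷ joints-unique u adj ≢s
  where
  apart : ∀ {e} → e ∈ pairs (c ∷ r) → sharedCorner a b ≢ uncurry sharedCorner e
  apart {x , y} xy∈ same = no-four-tiles-at-a-corner (Corner-sharedCornerˡ ab) (Corner-sharedCornerʳ ab)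
    (subst (λ p → Corner p x) (sym same) (Corner-sharedCornerˡ xy))
    (subst (λ p → Corner p y) (sym same) (Corner-sharedCornerʳ xy))
    ( (Adjacent⇒≢ ab ∷ All.lookup a∉ (there x∈) ∷ All.lookup a∉ (there y∈) ∷ [])
    ∷ (All.lookup b∉ x∈ ∷ All.lookup b∉ y∈ ∷ [])
    ∷ (Adjacent⇒≢ xy ∷ []) ∷ [] ∷ [])
    where
    xy : Adjacent x y
    xy = All.lookup adj′ xy∈
    x∈ : x ∈ c ∷ r
    x∈ = proj₁ (∈-pairs⁻ xy∈)
    y∈ : y ∈ c ∷ r
    y∈ = proj₂ (∈-pairs⁻ xy∈)

okTurns⇔distinctJoints : ∀ {x} → All (uncurry Adjacent) (pairs x) →
  All (λ (e , e′) → T (okTurn (dir e , dir e′))) (pairs (pairs x)) ⇔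
  All (λ (e , e′) → uncurry sharedCorner e ≢ uncurry sharedCorner e′) (pairs (pairs x))
okTurns⇔distinctJoints {[]} _ = mk⇔ (λ _ → []) (λ _ → [])
okTurns⇔distinctJoints {_ ∷ []} _ = mk⇔ (λ _ → []) (λ _ → [])
okTurns⇔distinctJoints {_ ∷ _ ∷ []} _ = mk⇔ (λ _ → []) (λ _ → [])
okTurns⇔distinctJoints {a ∷ b ∷ c ∷ r} (α ∷ adj@(β ∷ _)) with okTurns⇔distinctJoints adj
... | rest = mk⇔ (λ { (ok ∷ oks) → to (T-okTurn α β) ok ∷ to rest oks })
                 (λ { (d ∷ ds) → from (T-okTurn α β) d ∷ from rest ds })

T-wfPath : ∀ {x} → All (uncurry Adjacent) (pairs x) → T (wfPath x) ⇔ All (uncurry _≢_) (pairs (joints x))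
T-wfPath {x} adj = mk⇔
  (λ w → joints≢ (to (okTurns⇔distinctJoints adj) (All.map⁻ (subst (All (T ∘ okTurn)) dirs≡ (to T-all w)))))
  (λ d → from T-all (subst (All (T ∘ okTurn)) (sym dirs≡) (All.map⁺ (from (okTurns⇔distinctJoints adj) (joints≢⁻¹ d)))))
  where
  dirs≡ : pairs (map dir (pairs x)) ≡ map (Product.map dir dir) (pairs (pairs x))
  dirs≡ = pairs-map dir (pairs x)
  joints≡ : pairs (joints x) ≡ map (Product.map (uncurry sharedCorner) (uncurry sharedCorner)) (pairs (pairs x))
  joints≡ = pairs-map (uncurry sharedCorner) (pairs x)
  joints≢ : All (λ (e , e′) → uncurry sharedCorner e ≢ uncurry sharedCorner e′) (pairs (pairs x)) →
    All (uncurry _≢_) (pairs (joints x))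
  joints≢ = subst (All (uncurry _≢_)) (sym joints≡) ∘ All.map⁺
  joints≢⁻¹ : All (uncurry _≢_) (pairs (joints x)) →
    All (λ (e , e′) → uncurry sharedCorner e ≢ uncurry sharedCorner e′) (pairs (pairs x))
  joints≢⁻¹ = All.map⁻ ∘ subst (All (uncurry _≢_)) joints≡

-- The turns of a cycle are those of the walk once around it and one step further.
module _ {h y : Tile} {t : List Tile} where

  private
    x walk : List Tile
    x = h ∷ y ∷ t
    walk = (x ∷ʳ h) ∷ʳ y

    pairs-walk : pairs walk ≡ cyclicPairs x ∷ʳ (h , y)
    pairs-walk = pairs-∷ʳ x h y

  wfCycle≡wfPath-walk : wfCycle x ≡ wfPath walk
  wfCycle≡wfPath-walk = cong (all okTurn ∘ pairs)
    (trans (sym (map-++ dir (cyclicPairs x) [ (h , y) ])) (cong (map dir) (sym pairs-walk)))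

  pairs-joints-walk : pairs (joints walk) ≡ cyclicPairs (cycleJoints x)
  pairs-joints-walk = cong pairs
    (trans (cong (map (uncurry sharedCorner)) pairs-walk) (map-++ (uncurry sharedCorner) (cyclicPairs x) [ (h , y) ]))

  T-wfCycle : All (uncurry Adjacent) (cyclicPairs x) → T (wfCycle x) ⇔ All (uncurry _≢_) (cyclicPairs (cycleJoints x))
  T-wfCycle adj = mk⇔
    (λ w → subst (All (uncurry _≢_)) pairs-joints-walk (to (T-wfPath {walk} adj-walk) (subst T wfCycle≡wfPath-walk w)))
    (λ d → subst T (sym wfCycle≡wfPath-walk)
      (from (T-wfPath {walk} adj-walk) (subst (All (uncurry _≢_)) (sym pairs-joints-walk) d)))
    where
    adj-walk : All (uncurry Adjacent) (pairs walk)
    adj-walk = subst (All (uncurry Adjacent)) (sym pairs-walk) (All.++⁺ adj (All.head adj ∷ []))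

T-wfCycle-long : ∀ {x} → 2 ≤ length x → All (uncurry Adjacent) (cyclicPairs x) →
  T (wfCycle x) ⇔ All (uncurry _≢_) (cyclicPairs (cycleJoints x))
T-wfCycle-long {_ ∷ _ ∷ _} _ = T-wfCycle
T-wfCycle-long {_ ∷ []} (s≤s ())

Starts : Point → List Point → Set
Starts p [] = ⊥
Starts p (x ∷ _) = x ≡ p

Ends : Point → List Point → Set
Ends p [] = ⊥
Ends p (x ∷ xs) = lastOr x xs ≡ p

T-headIs : ∀ {p xs} → T (headIs p xs) ⇔ Starts p xs
T-headIs {p} {[]} = mk⇔ id id
T-headIs {p} {x ∷ xs} = mk⇔ (sym ∘ to (T-eqP {p} {x})) (from (T-eqP {p} {x}) ∘ sym)

T-lastIs : ∀ {p xs} → T (lastIs p xs) ⇔ Ends p xs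
T-lastIs {p} {[]} = mk⇔ id id
T-lastIs {p} {x ∷ []} = mk⇔ (sym ∘ to (T-eqP {p} {x})) (from (T-eqP {p} {x}) ∘ sym)
T-lastIs {p} {x ∷ y ∷ xs} = T-lastIs {p} {y ∷ xs}

Ends⇒∈ : ∀ {t ts} → Ends t ts → t ∈ ts
Ends⇒∈ {ts = x ∷ xs} refl = last∈ x xs
  where
  last∈ : ∀ x xs → lastOr x xs ∈ x ∷ xs
  last∈ x [] = here refl
  last∈ x (y ∷ xs) = there (last∈ y xs)

Chain-first : ∀ {p ps ts} → Chain (p ∷ ps) ts → 1 ≤ length ts → ∃ λ t → Starts t ts × Corner p t
Chain-first (step cp _ _) _ = _ , refl , cp

Chain-final : ∀ {p ps ts} → Chain (p ∷ ps) ts → 1 ≤ length ts → ∃ λ t → Ends t ts × Corner (lastOr p ps) t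
Chain-final c@(step _ _ _) _ = _ , refl , Chain-last c

-- Paths and cycles of the two graphs

module Correspondence (n k : ℕ) where

  N : ℕ
  N = n ^ k

  Dark : List Tile
  Dark = darkTiles n k

  Dark⊆box : Dark ⊆ box N
  Dark⊆box {i , j} t∈ = uncurry ∈-box⁺ (darkTiles-coordinates n k t∈)

  Corner-Dark⇒box : ∀ {p t} → Corner p t → t ∈ Dark → p ∈ box (suc N)
  Corner-Dark⇒box {t = i , j} c t∈ with darkTiles-coordinates n k t∈ | c
  ... | i<N , j<N | bottomLeft = ∈-box⁺ (ℕ.m<n⇒m<1+n i<N) (ℕ.m<n⇒m<1+n j<N)
  ... | i<N , j<N | bottomRight = ∈-box⁺ (s≤s i<N) (ℕ.m<n⇒m<1+n j<N)
  ... | i<N , j<N | apex = ∈-box⁺ (ℕ.m<n⇒m<1+n i<N) (s≤s j<N)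

  Corner-origin : ∀ {t} → Corner (0 , 0) t → t ≡ (0 , 0)
  Corner-origin bottomLeft = refl

  Corner-end : ∀ {M t} → M ≡ N → Corner (M , 0) t → t ∈ Dark → t ≡ (M ∸ 1 , 0)
  Corner-end {M} M≡N bottomLeft t∈ = ⊥-elim (ℕ.<-irrefl (trans (ℕ.+-identityʳ M) M≡N) (darkTiles-bound n k t∈))
  Corner-end _ bottomRight _ = refl

  sharedCorner≢origin : ∀ {a b} → Adjacent a b → sharedCorner a b ≢ (0 , 0)
  sharedCorner≢origin α at-origin = Adjacent⇒≢ α (trans
    (Corner-origin (subst (λ p → Corner p _) at-origin (Corner-sharedCornerˡ α)))
    (sym (Corner-origin (subst (λ p → Corner p _) at-origin (Corner-sharedCornerʳ α)))))

  sharedCorner≢end : ∀ {a b} → Adjacent a b → a ∈ Dark → b ∈ Dark → sharedCorner a b ≢ (N , 0)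
  sharedCorner≢end α a∈ b∈ at-end = Adjacent⇒≢ α (trans
    (Corner-end refl (subst (λ p → Corner p _) at-end (Corner-sharedCornerˡ α)) a∈)
    (sym (Corner-end refl (subst (λ p → Corner p _) at-end (Corner-sharedCornerʳ α)) b∈)))

  edgeTiles-single : ∀ {t e} → t ∈ Dark → T (isSideOf t e) → edgeTiles n k e ≡ [ t ]
  edgeTiles-single {e = e} t∈ side = Unique-singleton (Unique.filter⁺ _ (darkTiles-unique n k))
    (∈-filter⁺ (T? ∘ λ u → isSideOf u e) t∈ side)
    (λ u∈ → side-unique (proj₂ (∈-filter⁻ (T? ∘ λ u → isSideOf u e) {xs = Dark} u∈)) side)

  IsEdge : Point × Point → Set
  IsEdge e = T (nonEmpty (edgeTiles n k e))

  IsEdge-view : ∀ {e} → IsEdge e → ∃ λ t → edgeTiles n k e ≡ [ t ] × t ∈ Dark × T (isSideOf t e)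
  IsEdge-view {e} nonempty with edgeTiles n k e in eq
  ... | t ∷ _ = let t∈ , side = ∈-filter⁻ (T? ∘ λ u → isSideOf u e) {xs = Dark} (subst (t ∈_) (sym eq) (here refl)) in
    t , trans (sym eq) (edgeTiles-single t∈ side) , t∈ , side

  edgeTiles-swap : ∀ {p q} → IsEdge (p , q) → edgeTiles n k (q , p) ≡ edgeTiles n k (p , q)
  edgeTiles-swap {p} {q} e with IsEdge-view e
  ... | t , single , t∈ , side = let cp , cq , p≢q = to (T-isSideOf {t} {p} {q}) side in
    trans (edgeTiles-single t∈ (from (T-isSideOf {t} {q} {p}) (cq , cp , p≢q ∘ sym))) (sym single)

  IsEdge-swap : ∀ {e} → IsEdge e → IsEdge (swap e)
  IsEdge-swap ie = subst (T ∘ nonEmpty) (sym (edgeTiles-swap ie)) ie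

  T-tilingEdges : ∀ {es} → T (tilingEdges n k es) ⇔ (All IsEdge es × Unique (concatMap (edgeTiles n k) es))
  T-tilingEdges = mk⇔ (Product.map (to T-all) (to T-nodup) ∘ to T-∧) (from T-∧ ∘ Product.map (from T-all) (from T-nodup))

  T-allAdjacent : ∀ {es} → T (all (λ e → adjacentI (proj₁ e) (proj₂ e)) es) ⇔ All (uncurry Adjacent) es
  T-allAdjacent = mk⇔ (All.map (to T-adjacentI) ∘ to T-all) (from T-all ∘ All.map (from T-adjacentI))

  Chain⇒edges : ∀ {ps ts} → Chain ps ts → All (_∈ Dark) ts → All (uncurry _≢_) (pairs ps) →
    concatMap (edgeTiles n k) (pairs ps) ≡ ts × All IsEdge (pairs ps)
  Chain⇒edges end _ _ = refl , []
  Chain⇒edges (step cp cq c) (t∈ ∷ ts∈) (p≢q ∷ ≢s)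
    with Chain⇒edges c ts∈ ≢s | edgeTiles-single t∈ (from T-isSideOf (cp , cq , p≢q))
  ... | tiles≡ , edges | single = cong₂ _++_ single tiles≡ , subst (T ∘ nonEmpty) (sym single) tt ∷ edges

  edges⇒Chain : ∀ {p} ps → All IsEdge (pairs (p ∷ ps)) →
    let ts = concatMap (edgeTiles n k) (pairs (p ∷ ps)) in Chain (p ∷ ps) ts × All (_∈ Dark) ts
  edges⇒Chain [] _ = end , []
  edges⇒Chain {p} (q ∷ ps) (e ∷ es) with IsEdge-view e | edges⇒Chain ps es
  ... | t , single , t∈ , side | c , ts∈ rewrite single =
    let cp , cq , _ = to T-isSideOf side in step cp cq c , t∈ ∷ ts∈

  Hamiltonian : List Tile → Set
  Hamiltonian x = Unique x × x ⊆ Dark × Dark ⊆ x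

  T-hamiltonianI : ∀ {x} → T (hamiltonianI n k x) ⇔ Hamiltonian x
  T-hamiltonianI {x} = mk⇔ sound complete
    where
    sound : T (hamiltonianI n k x) → Hamiltonian x
    sound h = let u , rest = to T-∧ h ; sub , sup = to T-∧ rest in
      to T-nodup u , All.lookup (All.map (λ {t} → to (T-elem {t})) (to T-all sub)) ,
      All.lookup (All.map (λ {t} → to (T-elem {t})) (to T-all sup))
    complete : Hamiltonian x → T (hamiltonianI n k x)
    complete (u , sub , sup) = from T-∧ (from T-nodup u , from T-∧
      (from T-all (All.map (λ {t} → from (T-elem {t})) (All.tabulate sub)) ,
       from T-all (All.map (λ {t} → from (T-elem {t})) (All.tabulate sup))))

  Hamiltonian-length : ∀ {x} → Hamiltonian x → length x ≡ triangular n ^ k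
  Hamiltonian-length (u , sub , sup) =
    trans (ℕ.≤-antisym (Unique-length-≤ u sub) (Unique-length-≤ (darkTiles-unique n k) sup)) (darkTiles-length n k)

  covering⇒Hamiltonian : ∀ {x} → Unique x → x ⊆ Dark → length x ≡ triangular n ^ k → Hamiltonian x
  covering⇒Hamiltonian u sub len =
    u , sub , Unique-⊆-length⇒⊇ _≟ₚ_ u sub (ℕ.≤-reflexive (trans (darkTiles-length n k) (sym len)))

  record IsWFHamPath (x : List Tile) : Set where
    field
      hamiltonian : Hamiltonian x
      adjacent    : All (uncurry Adjacent) (pairs x)
      starts      : Starts (0 , 0) x
      ends        : Ends (N ∸ 1 , 0) x
      wellFormed  : All (uncurry _≢_) (pairs (joints x))

  T-wfHamPath : ∀ {x} → T (wfHamPath n k x) ⇔ IsWFHamPath x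
  T-wfHamPath {x} = mk⇔ sound complete
    where
    sound : T (wfHamPath n k x) → IsWFHamPath x
    sound h = let ham , h₁ = to T-∧ h ; adj , h₂ = to T-∧ h₁ ; st , h₃ = to T-∧ h₂ ; en , wf = to T-∧ h₃
                  adjacent = to T-allAdjacent adj in
      record { hamiltonian = to T-hamiltonianI ham ; adjacent = adjacent ; starts = to T-headIs st
             ; ends = to T-lastIs en ; wellFormed = to (T-wfPath adjacent) wf }
    complete : IsWFHamPath x → T (wfHamPath n k x)
    complete p = from T-∧ (from T-hamiltonianI hamiltonian , from T-∧ (from T-allAdjacent adjacent ,
      from T-∧ (from T-headIs starts , from T-∧ (from T-lastIs ends , from (T-wfPath adjacent) wellFormed))))
      where open IsWFHamPath p

  pathTiles : List Point → List Tile
  pathTiles ws = concatMap (edgeTiles n k) (pairs ws)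

  record IsTilingPath (ws : List Point) : Set where
    field
      unique      : Unique ws
      edges       : All IsEdge (pairs ws)
      tilesUnique : Unique (pathTiles ws)
      length≡     : length (pairs ws) ≡ triangular n ^ k
      starts      : Starts (0 , 0) ws
      ends        : Ends (N , 0) ws

  T-tilingPath : ∀ {ws} → T (tilingPath n k ws) ⇔ IsTilingPath ws
  T-tilingPath {ws} = mk⇔ sound complete
    where
    sound : T (tilingPath n k ws) → IsTilingPath ws
    sound h = let u , h₁ = to T-∧ h ; te , h₂ = to T-∧ h₁ ; len , h₃ = to T-∧ h₂ ; st , en = to T-∧ h₃
                  edges , tilesUnique = to T-tilingEdges te in
      record { unique = to T-nodup u ; edges = edges ; tilesUnique = tilesUnique ; length≡ = ≡ᵇ⇒≡ _ _ len
             ; starts = to T-headIs st ; ends = to T-lastIs en }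
    complete : IsTilingPath ws → T (tilingPath n k ws)
    complete p = from T-∧ (from T-nodup unique , from T-∧ (from T-tilingEdges (edges , tilesUnique) ,
      from T-∧ (≡⇒≡ᵇ _ _ length≡ , from T-∧ (from T-headIs starts , from T-lastIs ends))))
      where open IsTilingPath p

  pathPoints : List Tile → List Point
  pathPoints x = (0 , 0) ∷ joints x ∷ʳ (N , 0)

  ∈-joints⁻ : ∀ {x p} → All (uncurry Adjacent) (pairs x) → p ∈ joints x →
    ∃₂ λ a b → Adjacent a b × a ∈ x × b ∈ x × p ≡ sharedCorner a b
  ∈-joints⁻ adj p∈ with ∈-map⁻ (uncurry sharedCorner) p∈
  ... | (a , b) , ab∈ , refl = a , b , All.lookup adj ab∈ , proj₁ (∈-pairs⁻ ab∈) , proj₂ (∈-pairs⁻ ab∈) , refl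

  pathPoints-spec : 1 ≤ N → ∀ {x} → IsWFHamPath x →
    IsTilingPath (pathPoints x) × pathTiles (pathPoints x) ≡ x × pathPoints x ⊆ box (suc N)
  pathPoints-spec 1≤N {t ∷ ts} p = tiling , tiles≡ , in-box
    where
    open IsWFHamPath p
    x : List Tile
    x = t ∷ ts
    x⊆Dark : x ⊆ Dark
    x⊆Dark = proj₁ (proj₂ hamiltonian)
    end-corner : Corner (N , 0) (lastOr t ts)
    end-corner = subst (Corner (N , 0)) (sym ends)
      (subst (λ m → Corner (m , 0) (N ∸ 1 , 0)) (ℕ.m+[n∸m]≡n 1≤N) bottomRight)
    chain : Chain (pathPoints x) x
    chain = joints-Chain ts adjacent (subst (Corner (0 , 0)) (sym starts) bottomLeft) end-corner
    origin∉joints : All ((0 , 0) ≢_) (joints x)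
    origin∉joints = All.tabulate λ q∈ → let _ , _ , α , _ , _ , q≡ = ∈-joints⁻ adjacent q∈ in
      sharedCorner≢origin α ∘ trans (sym q≡) ∘ sym
    end∉joints : All ((N , 0) ≢_) (joints x)
    end∉joints = All.tabulate λ q∈ → let _ , _ , α , a∈ , b∈ , q≡ = ∈-joints⁻ adjacent q∈ in
      sharedCorner≢end α (x⊆Dark a∈) (x⊆Dark b∈) ∘ trans (sym q≡) ∘ sym
    points-unique : Unique (pathPoints x)
    points-unique = All.++⁺ origin∉joints ((λ eq → ℕ.<-irrefl (cong proj₁ eq) 1≤N) ∷ [])
      ∷ Unique.++⁺ (joints-unique (proj₁ hamiltonian) adjacent wellFormed) ([] ∷ [])
          (λ { (q∈ , here refl) → All.lookup end∉joints q∈ refl })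
    edges-result : pathTiles (pathPoints x) ≡ x × All IsEdge (pairs (pathPoints x))
    edges-result = Chain⇒edges chain (All.tabulate x⊆Dark) (Unique⇒pairs-≢ points-unique)
    tiles≡ : pathTiles (pathPoints x) ≡ x
    tiles≡ = proj₁ edges-result
    tiling : IsTilingPath (pathPoints x)
    tiling = record
      { unique = points-unique
      ; edges = proj₂ edges-result
      ; tilesUnique = subst Unique (sym tiles≡) (proj₁ hamiltonian)
      ; length≡ = trans (Chain-length chain) (Hamiltonian-length hamiltonian)
      ; starts = refl
      ; ends = lastOr-∷ʳ (0 , 0) (joints x) (N , 0)
      }
    in-box : pathPoints x ⊆ box (suc N)
    in-box w∈ = let u , u∈ , cw = Chain-corners chain w∈ in Corner-Dark⇒box cw (x⊆Dark u∈)

  pathTiles-spec : 1 ≤ triangular n ^ k → ∀ {ws} → IsTilingPath ws →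
    IsWFHamPath (pathTiles ws) × pathPoints (pathTiles ws) ≡ ws × pathTiles ws ⊆ box N
  pathTiles-spec 1≤T {w₀ ∷ rest} p with rest | initLast rest
  ... | .[] | [] = ⊥-elim (ℕ.<-irrefl (IsTilingPath.length≡ p) 1≤T)
  ... | .(I ∷ʳ w) | I ∷ʳ′ w = wf-ham , points≡ , Dark⊆box ∘ All.lookup ts⊆Dark
    where
    open IsTilingPath p
    ts : List Tile
    ts = pathTiles (w₀ ∷ I ∷ʳ w)
    chain : Chain (w₀ ∷ I ∷ʳ w) ts
    chain = proj₁ (edges⇒Chain (I ∷ʳ w) edges)
    ts⊆Dark : All (_∈ Dark) ts
    ts⊆Dark = proj₂ (edges⇒Chain (I ∷ʳ w) edges)
    consecutive≢ : All (uncurry _≢_) (pairs ts)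
    consecutive≢ = Unique⇒pairs-≢ tilesUnique
    ts-length : length ts ≡ triangular n ^ k
    ts-length = trans (sym (Chain-length chain)) length≡
    1≤ts : 1 ≤ length ts
    1≤ts = subst (1 ≤_) (sym ts-length) 1≤T
    joints≡ : joints ts ≡ I
    joints≡ = Chain-joints I chain consecutive≢
    w≡ : w ≡ (N , 0)
    w≡ = trans (sym (lastOr-∷ʳ w₀ I w)) ends
    wf-ham : IsWFHamPath ts
    wf-ham = record
      { hamiltonian = covering⇒Hamiltonian tilesUnique (All.lookup ts⊆Dark) ts-length
      ; adjacent = Chain-adjacent chain consecutive≢
      ; starts = let t , st , c = Chain-first chain 1≤ts in
          subst (λ u → Starts u ts) (Corner-origin (subst (λ q → Corner q t) starts c)) st
      ; ends = let t , en , c = Chain-final chain 1≤ts in subst (λ u → Ends u ts)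
          (Corner-end refl (subst (λ q → Corner q t) (trans (lastOr-∷ʳ w₀ I w) w≡) c) (All.lookup ts⊆Dark (Ends⇒∈ en)))
          en
      ; wellFormed = subst (All (uncurry _≢_) ∘ pairs) (sym joints≡)
          (Unique⇒pairs-≢ (Unique-++⁻ˡ I (AllPairs.tail unique)))
      }
    points≡ : pathPoints ts ≡ w₀ ∷ I ∷ʳ w
    points≡ = cong₂ _∷_ (sym starts) (cong₂ _∷ʳ_ joints≡ (sym w≡))

  paths-count : 1 ≤ N → 1 ≤ triangular n ^ k → numWFHamPaths n k ≡ numTilingPaths n k
  paths-count 1≤N 1≤T = count-≡ pathPoints pathTiles (listsOver-unique (box-unique N)) (listsOver-unique (box-unique (suc N)))
    (λ _ h → let tiling , back , in-box = pathPoints-spec 1≤N (to T-wfHamPath h) in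
      ∈-listsOver⁺ (IsTilingPath.unique tiling) in-box , from T-tilingPath tiling , back)
    (λ _ h → let wf-ham , back , in-box = pathTiles-spec 1≤T (to T-tilingPath h) in
      ∈-listsOver⁺ (proj₁ (IsWFHamPath.hamiltonian wf-ham)) in-box , from T-wfHamPath wf-ham , back)

  record IsWFHamCycle (x : List Tile) : Set where
    field
      hamiltonian : Hamiltonian x
      long        : 3 ≤ length x
      adjacent    : All (uncurry Adjacent) (cyclicPairs x)
      wellFormed  : All (uncurry _≢_) (cyclicPairs (cycleJoints x))

  cycleJoints-SameCycle : ∀ {x y} → All (uncurry Adjacent) (cyclicPairs x) → SameCycle x y →
    SameCycle (cycleJoints x) (cycleJoints y)
  cycleJoints-SameCycle adj =
    SameCycle-map-cyclicPairs (uncurry sharedCorner) (λ e∈ → sym (sharedCorner-sym (All.lookup adj e∈)))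

  IsWFHamCycle-resp : ∀ {x y} → SameCycle x y → IsWFHamCycle x → IsWFHamCycle y
  IsWFHamCycle-resp c p = record
    { hamiltonian = let u , sub , sup = hamiltonian in
        SameCycle-unique c u , sub ∘ SameCycle-∈ (SameCycle-sym c) , SameCycle-∈ c ∘ sup
    ; long = subst (3 ≤_) (sym (SameCycle-length c)) long
    ; adjacent = All-cyclicPairs-SameCycle Adjacent-sym c adjacent
    ; wellFormed = All-cyclicPairs-SameCycle (_∘ sym) (cycleJoints-SameCycle adjacent c) wellFormed
    }
    where open IsWFHamCycle p

  T-wfHamCycle : ∀ {x} → T (wfHamCycle n k x) ⇔ (IsWFHamCycle x × Canonical x)
  T-wfHamCycle {x} = mk⇔ sound complete
    where
    sound : T (wfHamCycle n k x) → IsWFHamCycle x × Canonical x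
    sound h = let ham , h₁ = to T-∧ h ; three , h₂ = to T-∧ h₁ ; adj , h₃ = to T-∧ h₂ ; wf , canonical = to T-∧ h₃
                  adjacent = to T-allAdjacent adj ; long = to T-3<ᵇ1+ three
                  2≤ = ℕ.≤-trans (ℕ.n≤1+n 2) long
                  adjacentʳ = All-cyclicPairs-SameCycle Adjacent-sym (SameCycle-reverse x) adjacent in
      record { hamiltonian = to T-hamiltonianI ham ; long = long ; adjacent = adjacent
             ; wellFormed = [ to (T-wfCycle-long {x} 2≤ adjacent)
                            , All-cyclicPairs-SameCycle (_∘ sym)
                                (cycleJoints-SameCycle adjacentʳ (SameCycle-sym (SameCycle-reverse x)))
                              ∘ to (T-wfCycle-long {reverse x} (subst (2 ≤_) (sym (length-reverse x)) 2≤) adjacentʳ) ]′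
                            (to (T-∨ {wfCycle x} {wfCycle (reverse x)}) wf) }
      , to T-canonicalCycle canonical
    complete : IsWFHamCycle x × Canonical x → T (wfHamCycle n k x)
    complete (p , canonical) = from T-∧ (from T-hamiltonianI hamiltonian , from T-∧ (from T-3<ᵇ1+ long ,
      from T-∧ (from T-allAdjacent adjacent , from T-∧ (from (T-∨ {wfCycle x} {wfCycle (reverse x)})
        (inj₁ (from (T-wfCycle-long {x} (ℕ.≤-trans (ℕ.n≤1+n 2) long) adjacent) wellFormed)) ,
      from T-canonicalCycle canonical))))
      where open IsWFHamCycle p

  cycleTiles : List Point → List Tile
  cycleTiles ws = concatMap (edgeTiles n k) (cyclicPairs ws)

  record IsTilingCycle (ws : List Point) : Set where
    field
      unique      : Unique ws
      long        : 3 ≤ length ws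
      edges       : All IsEdge (cyclicPairs ws)
      tilesUnique : Unique (cycleTiles ws)
      length≡     : length (cyclicPairs ws) ≡ triangular n ^ k

  T-tilingCycle : ∀ {ws} → T (tilingCycle n k ws) ⇔ (IsTilingCycle ws × Canonical ws)
  T-tilingCycle {ws} = mk⇔ sound complete
    where
    sound : T (tilingCycle n k ws) → IsTilingCycle ws × Canonical ws
    sound h = let u , h₁ = to T-∧ h ; three , h₂ = to T-∧ h₁ ; te , h₃ = to T-∧ h₂ ; len , canonical = to T-∧ h₃
                  edges , tilesUnique = to T-tilingEdges te in
      record { unique = to T-nodup u ; long = to T-3<ᵇ1+ three ; edges = edges ; tilesUnique = tilesUnique
             ; length≡ = ≡ᵇ⇒≡ _ _ len }
      , to T-canonicalCycle canonical
    complete : IsTilingCycle ws × Canonical ws → T (tilingCycle n k ws)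
    complete (p , canonical) = from T-∧ (from T-nodup unique , from T-∧ (from T-3<ᵇ1+ long ,
      from T-∧ (from T-tilingEdges (edges , tilesUnique) , from T-∧ (≡⇒≡ᵇ _ _ length≡ , from T-canonicalCycle canonical))))
      where open IsTilingCycle p

  -- The tile carrying an edge of O_n(k), with junk value (0 , 0) on non-edges.
  edgeTile : Point × Point → Tile
  edgeTile e = fromMaybe (0 , 0) (head (edgeTiles n k e))

  cycleTiles≡map-edgeTile : ∀ {ws} → All IsEdge (cyclicPairs ws) → cycleTiles ws ≡ map edgeTile (cyclicPairs ws)
  cycleTiles≡map-edgeTile {ws} = go (cyclicPairs ws)
    where
    go : ∀ es → All IsEdge es → concatMap (edgeTiles n k) es ≡ map edgeTile es
    go [] [] = refl
    go (e ∷ es) (ie ∷ ies) with IsEdge-view ie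
    ... | t , single , _ = trans (cong (_++ concatMap (edgeTiles n k) es) single)
      (cong₂ _∷_ (sym (cong (fromMaybe (0 , 0) ∘ head) single)) (go es ies))

  cycleTiles-SameCycle : ∀ {ws zs} → All IsEdge (cyclicPairs ws) → SameCycle ws zs → SameCycle (cycleTiles ws) (cycleTiles zs)
  cycleTiles-SameCycle {ws} {zs} edges c =
    subst₂ SameCycle (sym (cycleTiles≡map-edgeTile {ws} edges)) (sym (cycleTiles≡map-edgeTile {zs} edgesᶻ))
      (SameCycle-map-cyclicPairs edgeTile (λ e∈ → cong (fromMaybe (0 , 0) ∘ head) (edgeTiles-swap (All.lookup edges e∈))) c)
    where edgesᶻ = All-cyclicPairs-SameCycle IsEdge-swap c edges

  IsTilingCycle-resp : ∀ {ws zs} → SameCycle ws zs → IsTilingCycle ws → IsTilingCycle zs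
  IsTilingCycle-resp {ws} {zs} c p = record
    { unique = SameCycle-unique c unique
    ; long = subst (3 ≤_) (sym (SameCycle-length c)) long
    ; edges = All-cyclicPairs-SameCycle IsEdge-swap c edges
    ; tilesUnique = SameCycle-unique (cycleTiles-SameCycle edges c) tilesUnique
    ; length≡ = trans (length-cyclicPairs zs) (trans (SameCycle-length c) (trans (sym (length-cyclicPairs ws)) length≡))
    }
    where open IsTilingCycle p

  -- With a = c₀₁ and b = c_{last,0}, the joints are a ∷ m ∷ʳ b: the path t₀ … t_last makes a ∷ m
  -- duplicate-free, the rotated path t₁ … t₀ makes m ∷ʳ b duplicate-free, and a ≢ b are consecutive.
  cycleJoints-unique : ∀ {x} → IsWFHamCycle x → Unique (cycleJoints x)
  cycleJoints-unique {[]} p with IsWFHamCycle.long p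
  ... | ()
  cycleJoints-unique {_ ∷ []} p with IsWFHamCycle.long p
  ... | s≤s ()
  cycleJoints-unique {_ ∷ _ ∷ []} p with IsWFHamCycle.long p
  ... | s≤s (s≤s ())
  cycleJoints-unique {t₀ ∷ t₁ ∷ t₂ ∷ r} p =
    subst (Unique ∘ (a ∷_)) (sym joints-rx≡) (All.++⁺ (AllPairs.head am-unique) (a≢b ∷ []) ∷ mb-unique)
    where
    open IsWFHamCycle p
    x : List Tile
    x = t₀ ∷ t₁ ∷ t₂ ∷ r
    a b : Point
    a = sharedCorner t₀ t₁
    b = sharedCorner (lastOr t₂ r) t₀
    m : List Point
    m = joints (t₁ ∷ t₂ ∷ r)
    joints-rx≡ : joints (rotate x) ≡ m ∷ʳ b
    joints-rx≡ = trans (cong (map (uncurry sharedCorner)) (pairs-∷ʳ-lastOr t₁ (t₂ ∷ r) t₀))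
      (map-++ (uncurry sharedCorner) (pairs (t₁ ∷ t₂ ∷ r)) _)
    wf : All (uncurry _≢_) (pairs (a ∷ (m ∷ʳ b) ∷ʳ a))
    wf = subst (All (uncurry _≢_) ∘ pairs ∘ (a ∷_) ∘ (_∷ʳ a)) joints-rx≡ wellFormed
    am-unique : Unique (a ∷ m)
    am-unique = joints-unique (proj₁ hamiltonian) (All-pairs-++⁻ˡ x adjacent)
      (All-pairs-++⁻ˡ (a ∷ m) (subst (All (uncurry _≢_) ∘ pairs ∘ (a ∷_)) (++-assoc m [ b ] [ a ]) wf))
    mb-unique : Unique (m ∷ʳ b)
    mb-unique = subst Unique joints-rx≡ (joints-unique (SameCycle-unique (SameCycle-rotate x) (proj₁ hamiltonian))
      (All.tail adjacent) (subst (All (uncurry _≢_) ∘ pairs) (sym joints-rx≡) (All-pairs-++⁻ˡ (m ∷ʳ b) (All.tail wf))))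
    a≢b : a ≢ b
    a≢b a≡b = All.head (All.++⁻ʳ (pairs ((a ∷ m) ∷ʳ b)) (subst (All (uncurry _≢_)) (pairs-∷ʳ (a ∷ m) b a) wf))
      (sym a≡b)

  cycleJoints-spec : ∀ {x} → IsWFHamCycle x →
    IsTilingCycle (cycleJoints x) × SameCycle (cycleTiles (cycleJoints x)) x × cycleJoints x ⊆ box (suc N)
  cycleJoints-spec {[]} p with IsWFHamCycle.long p
  ... | ()
  cycleJoints-spec {t₀ ∷ []} p with IsWFHamCycle.long p
  ... | s≤s ()
  cycleJoints-spec {t₀ ∷ t₁ ∷ r} p =
    tiling , subst (λ ts → SameCycle ts x) (sym tiles≡) (SameCycle-sym (SameCycle-rotate x)) , in-box
    where
    open IsWFHamCycle p
    x : List Tile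
    x = t₀ ∷ t₁ ∷ r
    α : Adjacent t₀ t₁
    α = All.head adjacent
    a : Point
    a = sharedCorner t₀ t₁
    rx⊆Dark : rotate x ⊆ Dark
    rx⊆Dark = proj₁ (proj₂ hamiltonian) ∘ SameCycle-∈ (SameCycle-sym (SameCycle-rotate x))
    chain : Chain (cycleJoints x ∷ʳ a) (rotate x)
    chain = joints-Chain (r ∷ʳ t₀) (All.tail adjacent) (Corner-sharedCornerʳ α)
      (subst (Corner a) (sym (lastOr-∷ʳ t₁ r t₀)) (Corner-sharedCornerˡ α))
    edges-result : cycleTiles (cycleJoints x) ≡ rotate x × All IsEdge (cyclicPairs (cycleJoints x))
    edges-result = Chain⇒edges chain (All.tabulate rx⊆Dark) wellFormed
    tiles≡ : cycleTiles (cycleJoints x) ≡ rotate x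
    tiles≡ = proj₁ edges-result
    length-joints : length (cycleJoints x) ≡ length x
    length-joints = trans (length-map _ (cyclicPairs x)) (length-cyclicPairs x)
    tiling : IsTilingCycle (cycleJoints x)
    tiling = record
      { unique = cycleJoints-unique p
      ; long = subst (3 ≤_) (sym length-joints) long
      ; edges = proj₂ edges-result
      ; tilesUnique = subst Unique (sym tiles≡) (SameCycle-unique (SameCycle-rotate x) (proj₁ hamiltonian))
      ; length≡ = trans (length-cyclicPairs (cycleJoints x)) (trans length-joints (Hamiltonian-length hamiltonian))
      }
    in-box : cycleJoints x ⊆ box (suc N)
    in-box w∈ = let u , u∈ , cw = Chain-corners chain (∈-++⁺ˡ w∈) in Corner-Dark⇒box cw (rx⊆Dark u∈)

  cycleTiles-spec : ∀ {ws} → IsTilingCycle ws →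
    IsWFHamCycle (cycleTiles ws) × SameCycle (cycleJoints (cycleTiles ws)) ws × cycleTiles ws ⊆ box N
  cycleTiles-spec {[]} p with IsTilingCycle.long p
  ... | ()
  cycleTiles-spec {w₀ ∷ []} p with IsTilingCycle.long p
  ... | s≤s ()
  cycleTiles-spec {w₀ ∷ w₁ ∷ r} p = subst (λ ts → IsWFHamCycle ts × SameCycle (cycleJoints ts) ws × ts ⊆ box N) (sym ts≡)
    (wf-ham , subst (λ js → SameCycle js ws) (sym joints≡) (SameCycle-sym (SameCycle-rotate ws)) , Dark⊆box ∘ ts⊆Dark)
    where
    open IsTilingCycle p
    ws : List Point
    ws = w₀ ∷ w₁ ∷ r
    ss : List Tile
    ss = concatMap (edgeTiles n k) (pairs ((w₁ ∷ r) ∷ʳ w₀))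
    first : ∃ λ t → edgeTiles n k (w₀ , w₁) ≡ [ t ] × t ∈ Dark × T (isSideOf t (w₀ , w₁))
    first = IsEdge-view (All.head edges)
    s₀ : Tile
    s₀ = proj₁ first
    ts≡ : cycleTiles ws ≡ s₀ ∷ ss
    ts≡ = cong (_++ ss) (proj₁ (proj₂ first))
    s₀-corners : Corner w₀ s₀ × Corner w₁ s₀ × w₀ ≢ w₁
    s₀-corners = to (T-isSideOf {s₀} {w₀} {w₁}) (proj₂ (proj₂ (proj₂ first)))
    chain : Chain (ws ∷ʳ w₀) (s₀ ∷ ss)
    chain = subst (Chain _) ts≡ (proj₁ (edges⇒Chain ((w₁ ∷ r) ∷ʳ w₀) edges))
    closed : Chain ((ws ∷ʳ w₀) ∷ʳ w₁) ((s₀ ∷ ss) ∷ʳ s₀)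
    closed = Chain-∷ʳ chain (subst (λ q → Corner q s₀) (sym (lastOr-∷ʳ w₀ (w₁ ∷ r) w₀)) (proj₁ s₀-corners))
      (proj₁ (proj₂ s₀-corners))
    ts⊆Dark : s₀ ∷ ss ⊆ Dark
    ts⊆Dark = All.lookup (subst (All (_∈ Dark)) ts≡ (proj₂ (edges⇒Chain ((w₁ ∷ r) ∷ʳ w₀) edges)))
    ts-unique : Unique (s₀ ∷ ss)
    ts-unique = subst Unique ts≡ tilesUnique
    ts-long : 3 ≤ length (s₀ ∷ ss)
    ts-long = subst (3 ≤_) (trans (sym (length-cyclicPairs ws)) (Chain-length chain)) long
    consecutive≢ : All (uncurry _≢_) (cyclicPairs (s₀ ∷ ss))
    consecutive≢ = Unique⇒cyclicPairs-≢ ts-unique (ℕ.≤-pred (ℕ.≤-trans (ℕ.n≤1+n 2) ts-long))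
    joints≡ : cycleJoints (s₀ ∷ ss) ≡ rotate ws
    joints≡ = Chain-joints ((w₁ ∷ r) ∷ʳ w₀) closed consecutive≢
    wf-ham : IsWFHamCycle (s₀ ∷ ss)
    wf-ham = record
      { hamiltonian = covering⇒Hamiltonian ts-unique ts⊆Dark (trans (sym (Chain-length chain)) length≡)
      ; long = ts-long
      ; adjacent = Chain-adjacent closed consecutive≢
      ; wellFormed = subst (All (uncurry _≢_) ∘ cyclicPairs) (sym joints≡) (Unique⇒cyclicPairs-≢
          (SameCycle-unique (SameCycle-rotate ws) unique) (subst (1 ≤_) (sym (length-++ r)) (ℕ.m≤n+m 1 (length r))))
      }

  WFHamCycles TilingCycles : CycleProperty
  WFHamCycles = record
    { Holds = IsWFHamCycle ; resp = IsWFHamCycle-resp ; unique = proj₁ ∘ IsWFHamCycle.hamiltonian ; long = IsWFHamCycle.long }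
  TilingCycles = record
    { Holds = IsTilingCycle ; resp = IsTilingCycle-resp ; unique = IsTilingCycle.unique ; long = IsTilingCycle.long }

  cycles-count : numWFHamCycles n k ≡ numTilingCycles n k
  cycles-count = count-≡ (canonicalForm ∘ cycleJoints) (canonicalForm ∘ cycleTiles)
    (listsOver-unique (box-unique N)) (listsOver-unique (box-unique (suc N)))
    (λ _ h → let p , canonical = to T-wfHamCycle h
                 tiling , form , same , back = canonical-round-trip WFHamCycles TilingCycles cycleJoints cycleTiles
                   (proj₁ ∘ cycleJoints-spec) (cycleTiles-SameCycle ∘ IsTilingCycle.edges) (proj₁ ∘ proj₂ ∘ cycleJoints-spec)
                   p canonical in
      ∈-listsOver⁺ (IsTilingCycle.unique tiling) (proj₂ (proj₂ (cycleJoints-spec p)) ∘ SameCycle-∈ (SameCycle-sym same)) ,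
      from T-tilingCycle (tiling , form) , back)
    (λ _ h → let q , canonical = to T-tilingCycle h
                 wf-ham , form , same , back = canonical-round-trip TilingCycles WFHamCycles cycleTiles cycleJoints
                   (proj₁ ∘ cycleTiles-spec) (cycleJoints-SameCycle ∘ IsWFHamCycle.adjacent)
                   (proj₁ ∘ proj₂ ∘ cycleTiles-spec) q canonical in
      ∈-listsOver⁺ (proj₁ (IsWFHamCycle.hamiltonian wf-ham))
        (proj₂ (proj₂ (cycleTiles-spec q)) ∘ SameCycle-∈ (SameCycle-sym same)) ,
      from T-wfHamCycle (wf-ham , form) , back)

mainTheorem5 : (n k : ℕ) → 2 ≤ n → 1 ≤ k →
    (numWFHamPaths n k ≡ numTilingPaths n k) × (numWFHamCycles n k ≡ numTilingCycles n k)
mainTheorem5 n@(suc _) k _ _ = paths-count (ℕ.m^n>0 n k) (ℕ.m^n>0 (triangular n) k) , cycles-count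
  where open Correspondence n k
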